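{- Let $O$ be a lopsp-operation with inflation factor $k$. If $k$ is even, then $v_1$ is not of colour 1 and the predecoration $Q(O)$ is a quadrangulation with $\frac{k+4}{2}$ vertices. If $k$ is odd, then $v_1$ is of colour 1 and the predecoration $Q(O)$ is a quadrangulation with $\frac{k+5}{2}$ vertices.
   Context: A map is a connected multigraph (loops and parallel edges allowed) 2-cell embedded in a closed orientable surface; plane means embedded in the sphere. A face's size is the length of its boundary walk; a triangulation (quadrangulation) has all faces of size 3 (size 4). A lopsp-operation is a plane map $O$ together with a colouring $c:V_O\to\{0,1,2\}$ and three marked vertices $v_0,v_1,v_2$ such that: (1) $O$ is a triangulation; (2) no edge joins two vertices of the same colour; (3) $c(v_0)\neq 1$, $c(v_2)\neq 1$, if $c(v_1)=1$ then $\deg(v_1)=2$, and every vertex $v\notin\{v_0,v_1,v_2\}$ with $c(v)=1$ has degree 4. A vertex has colour $i$ if $c(v)=i$; an edge has colour $i$ if neither of its endpoints has colour $i$. The inflation factor of $O$ is the number of faces of $O$ divided by 2. The predecoration $Q(O)$ is the submap of $O$ consisting of all vertices of colours 0 and 2 and all edges of colour 1, together with, if $c(v_1)=1$, the vertex $v_1$ and the edge of colour 2 incident with $v_1$; it is a plane quadrangulation. -}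

module Defs where

open import Data.Nat using (ℕ; zero; suc; _+_; _*_; _<_)
open import Data.Fin using (Fin; zero; suc; _≟_)
open import Data.Fin.Permutation using (Permutation′; _⟨$⟩ʳ_)
open import Data.List using (List; length; filter; allFin)
open import Data.Product using (Σ; _×_; ∃)
open import Data.Sum using (_⊎_)
open import Relation.Nullary using (¬_)
open import Relation.Binary.PropositionalEquality using (_≡_; _≢_)
open import Function.Definitions using (Injective)

iter : {A : Set} → ℕ → (A → A) → A → A
iter zero    f x = x
iter (suc k) f x = f (iter k f x)

countFibre : {n m : ℕ} → (Fin n → Fin m) → Fin m → ℕ
countFibre {n} f v = length (filter (λ x → f x ≟ v) (allFin n))

-- Darts are Fin nD.
--   α : the edge involution (other end of the edge),
--   σ : rotation of darts around their vertex,
--   φ = σ ∘ α : the face permutation (boundary walk).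
-- Vertices are Fin nV, vert x = vertex at which dart x starts;
-- faces are Fin nF, face x = face whose boundary walk contains x.
record Map : Set where
  field
    nD nV nF : ℕ
    σ : Permutation′ nD
    α : Permutation′ nD
    vert : Fin nD → Fin nV
    face : Fin nD → Fin nF

  σf : Fin nD → Fin nD
  σf x = σ ⟨$⟩ʳ x

  αf : Fin nD → Fin nD
  αf x = α ⟨$⟩ʳ x

  φf : Fin nD → Fin nD
  φf x = σf (αf x)

  deg : Fin nV → ℕ
  deg v = countFibre vert v

  faceSize : Fin nF → ℕ
  faceSize f = countFibre face f

open Map public

data Reach (M : Map) : Fin (nD M) → Fin (nD M) → Set where
  here  : ∀ {x} → Reach M x x
  stepσ : ∀ {x y} → Reach M (σf M x) y → Reach M x y
  stepα : ∀ {x y} → Reach M (αf M x) y → Reach M x y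

record IsMap (M : Map) : Set where
  field
    α-invol   : ∀ x → αf M (αf M x) ≡ x
    α-nofix   : ∀ x → αf M x ≢ x
    vert-surj : ∀ v → ∃ λ x → vert M x ≡ v
    vert-orb₁ : ∀ x y → vert M x ≡ vert M y → ∃ λ k → iter k (σf M) x ≡ y
    vert-orb₂ : ∀ x k → vert M (iter k (σf M) x) ≡ vert M x
    face-surj : ∀ f → ∃ λ x → face M x ≡ f
    face-orb₁ : ∀ x y → face M x ≡ face M y → ∃ λ k → iter k (φf M) x ≡ y
    face-orb₂ : ∀ x k → face M (iter k (φf M) x) ≡ face M x
    connected : ∀ x y → Reach M x y

-- plane (genus 0): Euler's formula V - E + F = 2 with E = nD/2
IsPlane : Map → Set
IsPlane M = 2 * (nV M + nF M) ≡ 4 + nD M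

IsPlaneTriangulation : Map → Set
IsPlaneTriangulation M = IsMap M × IsPlane M × (∀ f → faceSize M f ≡ 3)

IsPlaneQuadrangulation : Map → Set
IsPlaneQuadrangulation M = IsMap M × IsPlane M × (∀ f → faceSize M f ≡ 4)

col0 col1 col2 : Fin 3
col0 = zero
col1 = suc zero
col2 = suc (suc zero)

record IsLopsp (O : Map) (c : Fin (nV O) → Fin 3) (v₀ v₁ v₂ : Fin (nV O)) : Set where
  field
    triang   : IsPlaneTriangulation O
    proper   : ∀ x → c (vert O x) ≢ c (vert O (αf O x))
    v₀-col   : c v₀ ≢ col1
    v₂-col   : c v₂ ≢ col1
    v₁-deg   : c v₁ ≡ col1 → deg O v₁ ≡ 2
    other-deg : ∀ v → v ≢ v₀ → v ≢ v₁ → v ≢ v₂ → c v ≡ col1 → deg O v ≡ 4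

-- darts of O belonging to the predecoration Q(O):
-- darts of edges of colour 1 (no endpoint of colour 1), and, if c v₁ = 1,
-- darts of the edge of colour 2 (no endpoint of colour 2) incident with v₁.
InQ : (O : Map) (c : Fin (nV O) → Fin 3) (v₁ : Fin (nV O)) → Fin (nD O) → Set
InQ O c v₁ x =
  (c (vert O x) ≢ col1 × c (vert O (αf O x)) ≢ col1)
  ⊎ (c v₁ ≡ col1 × (vert O x ≡ v₁ ⊎ vert O (αf O x) ≡ v₁)
       × c (vert O x) ≢ col2 × c (vert O (αf O x)) ≢ col2)

-- Q is (isomorphic to) the submap of O on the dart set InQ, via the
-- dart embedding ι: edges are inherited, and the rotation at a vertex of Q
-- is the rotation of O restricted to the kept darts.
record IsPredecorationVia (O : Map) (c : Fin (nV O) → Fin 3) (v₁ : Fin (nV O))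
                          (Q : Map) (ι : Fin (nD Q) → Fin (nD O)) : Set where
  field
    ι-inj   : Injective _≡_ _≡_ ι
    ι-in    : ∀ y → InQ O c v₁ (ι y)
    ι-onto  : ∀ x → InQ O c v₁ x → ∃ λ y → ι y ≡ x
    ι-α     : ∀ y → ι (αf Q y) ≡ αf O (ι y)
    ι-σ     : ∀ y → Σ ℕ λ j → 0 < j × iter j (σf O) (ι y) ≡ ι (σf Q y)
                × (∀ i → 0 < i → i < j → ¬ InQ O c v₁ (iter i (σf O) (ι y)))

{-# OPTIONS --safe #-}
-- Every triangle of the properly 3-coloured triangulation O has one corner of each colour. Counting
-- the darts at colour-1 vertices once by faces and once by degrees (4, except 2 at v₁) gives
-- 2k + 2[v₁≡1] = 4n₁, where n₁ is the number of colour-1 vertices; so c v₁ = 1 exactly when k is odd.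
-- The darts of Q are those of O on the edges of Q(O), with α restricted and σ replaced by its first
-- return to them. Going around a face of Q stays in the star of one colour-1 vertex, turning
-- through its four triangles (through the two triangles at v₁ and twice along its colour-2 edge), so
-- Q is a quadrangulation with n₁ faces. Its vertices are those of O but the n₁ − [v₁≡1] other
-- colour-1 ones, and Euler's formula for O (nV = k + 2) gives 2 nV Q = k + [v₁≡1] + 4.
module Submission where

open import Defs
open import Data.Nat using (ℕ; zero; suc; _+_; _*_; _∸_; _≤_; _<_; z≤n; s≤s)
open import Data.Nat.Properties
  using ( +-*-semiring; +-comm; +-assoc; +-identityʳ; +-suc; *-comm; *-identityˡ; *-assoc; *-zeroʳ; *-suc; *-distribˡ-+
        ; +-cancelʳ-≡; *-cancelˡ-≡; ≤-antisym; ≤-pred; <-irrefl; <-cmp; <⇒≤; n≤0⇒n≡0; m≤n⇒m<n∨m≡n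
        ; m<n⇒0<n∸m; ∸-monoʳ-<; m+[n∸m]≡n; m∸n+n≡m )
open import Data.Nat.Divisibility using (_∣_; ∣m+n∣m⇒∣n; ∣1⇒≡1; m∣m*n)
open import Data.Nat.Induction using (<-wellFounded)
open import Data.Nat.Tactic.RingSolver using (solve-∀)
open import Data.Fin using (Fin; zero; suc; _≟_; toℕ)
open import Data.Fin.Patterns using (0F; 1F; 2F; 3F)
open import Data.Fin.Properties using (injective⇒≤; any?; punchInᵢ≢i; suc-injective)
open import Data.Fin.Permutation using (Permutation′; permutation; _⟨$⟩ˡ_; inverseʳ)
open import Data.Vec.Functional using (Vector; []; _∷_; removeAt)
open import Data.Bool using (if_then_else_)
open import Data.List using (length; filter; tabulate)
open import Data.Product using (Σ; ∃; _×_; _,_; proj₁; proj₂)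
open import Data.Sum using (_⊎_; inj₁; inj₂)
open import Data.Unit using (tt)
open import Function using (_∘_; id)
open import Function.Bundles using (Injection)
open import Function.Definitions using (Injective)
open import Function.Properties.Inverse using (↔⇒↣)
open import Induction.WellFounded using (Acc; acc)
open import Relation.Nullary using (¬_; Dec; yes; no; does; ¬?; _×-dec_; _⊎-dec_; contradiction)
open import Relation.Nullary.Decidable using (decidable-stable)
open import Relation.Unary using (Decidable)
open import Relation.Unary.Properties using (U?)
open import Relation.Binary.Definitions using (tri<; tri≈; tri>)
open import Relation.Binary.PropositionalEquality
open import Algebra.Properties.Semiring.Sum +-*-semiring
  using (sum; sum-syntax; sum-cong-≗; sum-remove; ∑-comm; ∑-distrib-+; *-distribˡ-sum; *-distribʳ-sum)

indicator : {A : Set} → Dec A → ℕ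
indicator d = if does d then 1 else 0

indicator-yes : ∀ {A : Set} (d : Dec A) → A → indicator d ≡ 1
indicator-yes (yes _) _ = refl
indicator-yes (no ¬a) a = contradiction a ¬a

indicator-no : ∀ {A : Set} (d : Dec A) → ¬ A → indicator d ≡ 0
indicator-no (yes a) ¬a = contradiction a ¬a
indicator-no (no _)  _  = refl

indicator-*-cong : ∀ {A : Set} (d : Dec A) {m n} → (A → m ≡ n) → indicator d * m ≡ indicator d * n
indicator-*-cong (yes a) m≡n = cong (1 *_) (m≡n a)
indicator-*-cong (no _)  _   = refl

count : ∀ {n} {P : Fin n → Set} → Decidable P → ℕ
count {n} P? = ∑[ x < n ] indicator (P? x)

length-filter-tabulate : ∀ {A : Set} {P : A → Set} (P? : Decidable P) {n} (f : Fin n → A)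
                       → length (filter P? (tabulate f)) ≡ count (P? ∘ f)
length-filter-tabulate P? {zero} f = refl
length-filter-tabulate P? {suc n} f with P? (f zero)
... | yes _ = cong suc (length-filter-tabulate P? (f ∘ suc))
... | no _  = length-filter-tabulate P? (f ∘ suc)

countFibre≡count : ∀ {n m} (f : Fin n → Fin m) v → countFibre f v ≡ count (λ x → f x ≟ v)
countFibre≡count f v = length-filter-tabulate (λ x → f x ≟ v) id

count-all : ∀ {n} {P : Fin n → Set} (P? : Decidable P) → (∀ x → P x) → count P? ≡ n
count-all {zero} P? all = refl
count-all {suc n} P? all with P? zero
... | yes _ = cong suc (count-all (P? ∘ suc) (all ∘ suc))
... | no ¬p = contradiction (all zero) ¬p

count-+ : ∀ {n} {A B C D : Fin n → Set}
          (A? : Decidable A) (B? : Decidable B) (C? : Decidable C) (D? : Decidable D)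
        → (∀ x → indicator (A? x) + indicator (B? x) ≡ indicator (C? x) + indicator (D? x))
        → count A? + count B? ≡ count C? + count D?
count-+ {n} A? B? C? D? pointwise = begin
  count A? + count B?                              ≡⟨ ∑-distrib-+ (indicator ∘ A?) (indicator ∘ B?) ⟨
  ∑[ x < n ] (indicator (A? x) + indicator (B? x)) ≡⟨ sum-cong-≗ pointwise ⟩
  ∑[ x < n ] (indicator (C? x) + indicator (D? x)) ≡⟨ ∑-distrib-+ (indicator ∘ C?) (indicator ∘ D?) ⟩
  count C? + count D?                              ∎
  where open ≡-Reasoning

record Enumeration {n} (P : Fin n → Set) (m : ℕ) : Set where
  field
    embed           : Fin m → Fin n
    embed-injective : Injective _≡_ _≡_ embed
    embed-∈         : ∀ i → P (embed i)
    index           : ∀ x → P x → Fin m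
    embed-index     : ∀ x p → embed (index x p) ≡ x

enumerate : ∀ {n} {P : Fin n → Set} (P? : Decidable P) → Enumeration P (count P?)
enumerate {zero} P? = record
  { embed = λ () ; embed-injective = λ {} ; embed-∈ = λ () ; index = λ () ; embed-index = λ () }
enumerate {suc n} {P} P? = extend (P? zero) (enumerate (P? ∘ suc))
  where
  extend : ∀ {m} (d : Dec (P zero)) → Enumeration (P ∘ suc) m → Enumeration P (indicator d + m)
  extend {m} (yes p₀) E = record
    { embed = embed ; embed-injective = injective ; embed-∈ = ∈ ; index = index ; embed-index = embed-index }
    where
    module E = Enumeration E
    embed : Fin (suc m) → Fin (suc n)
    embed zero    = zero
    embed (suc i) = suc (E.embed i)
    injective : Injective _≡_ _≡_ embed
    injective {zero}  {zero}  _ = refl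
    injective {suc i} {suc j} e = cong suc (E.embed-injective (suc-injective e))
    ∈ : ∀ i → P (embed i)
    ∈ zero    = p₀
    ∈ (suc i) = E.embed-∈ i
    index : ∀ x → P x → Fin (suc m)
    index zero    _ = zero
    index (suc x) p = suc (E.index x p)
    embed-index : ∀ x p → embed (index x p) ≡ x
    embed-index zero    _ = refl
    embed-index (suc x) p = cong suc (E.embed-index x p)
  extend {m} (no ¬p₀) E = record
    { embed = suc ∘ E.embed
    ; embed-injective = E.embed-injective ∘ suc-injective
    ; embed-∈ = E.embed-∈
    ; index = index
    ; embed-index = embed-index
    }
    where
    module E = Enumeration E
    index : ∀ x → P x → Fin m
    index zero    p = contradiction p ¬p₀
    index (suc x) p = E.index x p
    embed-index : ∀ x p → suc (E.embed (index x p)) ≡ x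
    embed-index zero    p = contradiction p ¬p₀
    embed-index (suc x) p = cong suc (E.embed-index x p)

∷-injective : ∀ {A : Set} {r} {a : A} {g : Vector A r}
            → Injective _≡_ _≡_ g → (∀ i → g i ≢ a) → Injective _≡_ _≡_ (a ∷ g)
∷-injective g-inj fresh {zero}  {zero}  _ = refl
∷-injective g-inj fresh {zero}  {suc j} e = contradiction (sym e) (fresh j)
∷-injective g-inj fresh {suc i} {zero}  e = contradiction e (fresh i)
∷-injective g-inj fresh {suc i} {suc j} e = cong suc (g-inj e)

[]-injective : ∀ {A : Set} → Injective _≡_ _≡_ ([] {A = A})
[]-injective {x = ()}

module _ {n} {P : Fin n → Set} (P? : Decidable P) where
  private module E = Enumeration (enumerate P?)

  count-≤ : ∀ {m} (f : ∀ x → P x → Fin m) → (∀ {x y} p q → f x p ≡ f y q → x ≡ y) → count P? ≤ m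
  count-≤ f f-inj = injective⇒≤ {f = λ i → f (E.embed i) (E.embed-∈ i)}
    (λ e → E.embed-injective (f-inj _ _ e))

  ≤-count : ∀ {r} (g : Vector (Fin n) r) → Injective _≡_ _≡_ g → (∀ i → P (g i)) → r ≤ count P?
  ≤-count g g-inj g∈ = injective⇒≤ {f = λ i → E.index (g i) (g∈ i)}
    (λ e → g-inj (trans (sym (E.embed-index _ _)) (trans (cong E.embed e) (E.embed-index _ _))))

  count-≤-cover : ∀ {r} (g : Vector (Fin n) r) → (∀ x → P x → ∃ λ i → g i ≡ x) → count P? ≤ r
  count-≤-cover g cover = count-≤ (λ x p → proj₁ (cover x p))
    (λ p q e → trans (sym (proj₂ (cover _ p))) (trans (cong g e) (proj₂ (cover _ q))))

  count-none : (∀ x → ¬ P x) → count P? ≡ 0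
  count-none ¬P = n≤0⇒n≡0 (count-≤-cover [] (λ x p → contradiction p (¬P x)))

  count-≡ : ∀ {r} (g : Vector (Fin n) r) → Injective _≡_ _≡_ g → (∀ i → P (g i))
          → (∀ x → P x → ∃ λ i → g i ≡ x) → count P? ≡ r
  count-≡ g g-inj g∈ cover = ≤-antisym (count-≤-cover g cover) (≤-count g g-inj g∈)

  -- If the count is already attained by g, any further element would give one too many.
  count-image : ∀ {r} → count P? ≡ r → (g : Vector (Fin n) r) → Injective _≡_ _≡_ g → (∀ i → P (g i))
              → ∀ x → P x → ∃ λ i → g i ≡ x
  count-image {r} count≡r g g-inj g∈ x p with any? (λ i → g i ≟ x)
  ... | yes found = found
  ... | no ¬found = contradiction (subst (suc r ≤_) count≡r (≤-count (x ∷ g) (∷-injective g-inj fresh) ∈))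
                                  (<-irrefl refl)
    where
    fresh : ∀ i → g i ≢ x
    fresh i e = ¬found (i , e)
    ∈ : ∀ i → P ((x ∷ g) i)
    ∈ zero    = p
    ∈ (suc i) = g∈ i

module _ {n m} {P : Fin n → Set} {R : Fin m → Set} (P? : Decidable P) (R? : Decidable R) where
  private module R = Enumeration (enumerate R?)

  count-≤-injection : (f : ∀ x → P x → Fin m) → (∀ x p → R (f x p))
                    → (∀ {x y} p q → f x p ≡ f y q → x ≡ y) → count P? ≤ count R?
  count-≤-injection f f-∈ f-inj = count-≤ P? (λ x p → R.index (f x p) (f-∈ x p))
    (λ p q e → f-inj p q (trans (sym (R.embed-index _ _)) (trans (cong R.embed e) (R.embed-index _ _))))

injective⇒surjective : ∀ {n} (f : Fin n → Fin n) → Injective _≡_ _≡_ f → ∀ y → ∃ λ x → f x ≡ y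
injective⇒surjective {n} f f-inj y = count-image U? (count-all U? (λ _ → tt)) f f-inj (λ _ → tt) y tt

injective⇒permutation : ∀ {n} (f : Fin n → Fin n) → Injective _≡_ _≡_ f → Permutation′ n
injective⇒permutation f f-inj = permutation f (proj₁ ∘ surj) (proj₂ ∘ surj) (λ x → f-inj (proj₂ (surj (f x))))
  where surj = injective⇒surjective f f-inj

∑-const : ∀ m k → ∑[ i < m ] k ≡ k * m
∑-const zero    k = sym (*-zeroʳ k)
∑-const (suc m) k = trans (cong (k +_) (∑-const m k)) (sym (*-suc k m))

∑-delta : ∀ {m} (g : Fin m → ℕ) (a : Fin m) → ∑[ v < m ] (indicator (a ≟ v) * g v) ≡ g a
∑-delta {suc m} g zero    = trans (cong (1 * g zero +_) (∑-const m 0)) (trans (+-identityʳ _) (*-identityˡ _))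
∑-delta {suc m} g (suc a) = ∑-delta (g ∘ suc) a

∑-fibres : ∀ {n m} (f : Fin n → Fin m) {P : Fin m → Set} (P? : Decidable P)
         → ∑[ v < m ] (indicator (P? v) * count (λ x → f x ≟ v)) ≡ count (P? ∘ f)
∑-fibres {n} {m} f P? = begin
  ∑[ v < m ] (p v * ∑[ x < n ] e x v)   ≡⟨ sum-cong-≗ (λ v → *-distribˡ-sum (p v) (λ x → e x v)) ⟩
  ∑[ v < m ] ∑[ x < n ] (p v * e x v)   ≡⟨ ∑-comm (λ v x → p v * e x v) ⟩
  ∑[ x < n ] ∑[ v < m ] (p v * e x v)   ≡⟨ sum-cong-≗ (λ x → sum-cong-≗ (λ v → *-comm (p v) (e x v))) ⟩
  ∑[ x < n ] ∑[ v < m ] (e x v * p v)   ≡⟨ sum-cong-≗ (λ x → ∑-delta p (f x)) ⟩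
  count (P? ∘ f)                        ∎
  where
  open ≡-Reasoning
  p : Fin m → ℕ
  p v = indicator (P? v)
  e : Fin n → Fin m → ℕ
  e x v = indicator (f x ≟ v)

fibres-of-size : ∀ {n m} (f : Fin n → Fin m) s → (∀ v → countFibre f v ≡ s) → n ≡ s * m
fibres-of-size {n} {m} f s size = begin
  n                                         ≡⟨ count-all (U? {A = Fin n}) (λ _ → tt) ⟨
  count (U? {A = Fin n})                    ≡⟨ ∑-fibres f U? ⟨
  ∑[ v < m ] (1 * count (λ x → f x ≟ v))    ≡⟨ sum-cong-≗ (λ v → trans (*-identityˡ _) (fibre v)) ⟩
  ∑[ v < m ] s                              ≡⟨ ∑-const m s ⟩
  s * m                                     ∎
  where
  open ≡-Reasoning
  fibre : ∀ v → count (λ x → f x ≟ v) ≡ s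
  fibre v = trans (sym (countFibre≡count f v)) (size v)

∑-agree-except : ∀ {m} (g h : Fin m → ℕ) (a : Fin m) → (∀ v → v ≢ a → g v ≡ h v)
               → sum g + h a ≡ sum h + g a
∑-agree-except {suc m} g h a agree = begin
  sum g + h a                              ≡⟨ cong (_+ h a) (sum-remove g) ⟩
  g a + sum (removeAt g a) + h a           ≡⟨ cong (λ t → g a + t + h a) (sum-cong-≗ (agree _ ∘ punchInᵢ≢i a)) ⟩
  g a + sum (removeAt h a) + h a           ≡⟨ +-comm (g a + _) (h a) ⟩
  h a + (g a + sum (removeAt h a))         ≡⟨ cong (h a +_) (+-comm (g a) _) ⟩
  h a + (sum (removeAt h a) + g a)         ≡⟨ +-assoc (h a) _ (g a) ⟨
  h a + sum (removeAt h a) + g a           ≡⟨ cong (_+ g a) (sum-remove h) ⟨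
  sum h + g a                              ∎
  where open ≡-Reasoning

iter-sucʳ : ∀ {A : Set} k (f : A → A) x → iter (suc k) f x ≡ iter k f (f x)
iter-sucʳ zero    f x = refl
iter-sucʳ (suc k) f x = cong f (iter-sucʳ k f x)

iter-+ : ∀ {A : Set} a b (f : A → A) x → iter (a + b) f x ≡ iter a f (iter b f x)
iter-+ zero    b f x = refl
iter-+ (suc a) b f x = cong f (iter-+ a b f x)

iter-injective : ∀ {A : Set} k {f : A → A} → Injective _≡_ _≡_ f → Injective _≡_ _≡_ (iter k f)
iter-injective zero    f-inj e = e
iter-injective (suc k) f-inj e = iter-injective k f-inj (f-inj e)

iter-preserves : ∀ {A : Set} (S : A → Set) {f : A → A} → (∀ {y} → S y → S (f y))
               → ∀ {x} → S x → ∀ k → S (iter k f x)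
iter-preserves S closed Sx zero    = Sx
iter-preserves S closed Sx (suc k) = closed (iter-preserves S closed Sx k)

-- The map induced by π on a subset P: send x ∈ P to the first later point of its π-orbit in P.
module FirstReturn {n} (π : Fin n → Fin n) (π-injective : Injective _≡_ _≡_ π)
                   (returns : ∀ x → ∃ λ m → iter (suc m) π x ≡ x)
                   {P : Fin n → Set} (P? : Decidable P) where
  open Enumeration (enumerate P?)

  Avoids : Fin n → ℕ → Set
  Avoids x j = ∀ i → 0 < i → i < j → ¬ P (iter i π x)

  record Return (x : Fin n) : Set where
    field
      steps   : ℕ
      steps>0 : 0 < steps
      hit     : P (iter steps π x)
      avoids  : Avoids x steps

  open Return

  avoids-suc : ∀ {x i} → Avoids x i → ¬ P (iter i π x) → Avoids x (suc i)
  avoids-suc av ¬p i′ i′>0 i′<1+i with m≤n⇒m<n∨m≡n (≤-pred i′<1+i)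
  ... | inj₁ i′<i = av i′ i′>0 i′<i
  ... | inj₂ refl = ¬p

  search : ∀ x i d → 0 < i → Avoids x i → P (iter (i + d) π x) → Return x
  search x i d i>0 av p with P? (iter i π x)
  ... | yes pᵢ = record { steps = i ; steps>0 = i>0 ; hit = pᵢ ; avoids = av }
  search x i zero    i>0 av p | no ¬pᵢ = contradiction (subst (λ t → P (iter t π x)) (+-identityʳ i) p) ¬pᵢ
  search x i (suc d) i>0 av p | no ¬pᵢ =
    search x (suc i) d (s≤s z≤n) (avoids-suc av ¬pᵢ) (subst (λ t → P (iter t π x)) (+-suc i d) p)

  -- Opaque, so that conversion checking never unfolds the search.
  opaque
    return : ∀ x → P x → Return x
    return x p = let m , e = returns x in
      search x 1 m (s≤s z≤n) (λ { (suc _) _ (s≤s ()) }) (subst P (sym e) p)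

  return-unique : ∀ {x} (r r′ : Return x) → steps r ≡ steps r′
  return-unique r r′ with <-cmp (steps r) (steps r′)
  ... | tri< lt _ _ = contradiction (hit r) (avoids r′ _ (steps>0 r) lt)
  ... | tri≈ _ eq _ = eq
  ... | tri> _ _ gt = contradiction (hit r′) (avoids r _ (steps>0 r′) gt)

  induced-return : ∀ y → Return (embed y)
  induced-return y = return (embed y) (embed-∈ y)

  opaque
    induced : Fin (count P?) → Fin (count P?)
    induced y = index (iter (steps (induced-return y)) π (embed y)) (hit (induced-return y))

    induced-image : ∀ y → embed (induced y) ≡ iter (steps (induced-return y)) π (embed y)
    induced-image y = embed-index _ _

  embed-induced : ∀ y (r : Return (embed y)) → embed (induced y) ≡ iter (steps r) π (embed y)
  embed-induced y r =
    trans (induced-image y) (cong (λ t → iter t π (embed y)) (return-unique (induced-return y) r))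

  embed-induced-next : ∀ y → P (π (embed y)) → embed (induced y) ≡ π (embed y)
  embed-induced-next y p = embed-induced y (record
    { steps = 1 ; steps>0 = s≤s z≤n ; hit = p ; avoids = λ { (suc _) _ (s≤s ()) } })

  embed-induced-skip : ∀ y → ¬ P (π (embed y)) → P (π (π (embed y))) → embed (induced y) ≡ π (π (embed y))
  embed-induced-skip y ¬p p = embed-induced y (record { steps = 2 ; steps>0 = s≤s z≤n ; hit = p ; avoids = av })
    where
    av : Avoids (embed y) 2
    av (suc zero) _ _ = ¬p
    av (suc (suc _)) _ (s≤s (s≤s ()))

  private
    -- A shorter return lands strictly inside a longer one, where P was avoided.
    no-overtaking : ∀ {x x′} j (r′ : Return x′) → P x → 0 < j → j < steps r′
                  → iter j π x ≢ iter (steps r′) π x′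
    no-overtaking {x} {x′} j r′ p j>0 j<s e =
      avoids r′ (steps r′ ∸ j) (m<n⇒0<n∸m j<s) (∸-monoʳ-< j>0 (<⇒≤ j<s))
        (subst P (iter-injective j π-injective (begin
          iter j π x                                   ≡⟨ e ⟩
          iter (steps r′) π x′                         ≡⟨ cong (λ t → iter t π x′) (m+[n∸m]≡n (<⇒≤ j<s)) ⟨
          iter (j + (steps r′ ∸ j)) π x′               ≡⟨ iter-+ j _ π x′ ⟩
          iter j π (iter (steps r′ ∸ j) π x′)          ∎)) p)
      where open ≡-Reasoning

  private
    same-image : ∀ {y y′} → induced y ≡ induced y′
               → iter (steps (induced-return y)) π (embed y) ≡ iter (steps (induced-return y′)) π (embed y′)
    same-image {y} {y′} e = trans (sym (induced-image y)) (trans (cong embed e) (induced-image y′))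

  induced-injective : Injective _≡_ _≡_ induced
  induced-injective {y} {y′} e with <-cmp (steps (induced-return y)) (steps (induced-return y′))
  ... | tri< lt _ _ = contradiction (same-image e)
                        (no-overtaking _ (induced-return y′) (embed-∈ y) (steps>0 (induced-return y)) lt)
  ... | tri> _ _ gt = contradiction (sym (same-image e))
                        (no-overtaking _ (induced-return y) (embed-∈ y′) (steps>0 (induced-return y′)) gt)
  ... | tri≈ _ eq _ = embed-injective (iter-injective (steps (induced-return y)) π-injective
                        (trans (same-image e) (cong (λ t → iter t π (embed y′)) (sym eq))))

  induced-orbit : ∀ m {y y′} → iter m π (embed y) ≡ embed y′ → ∃ λ k → iter k induced y ≡ y′
  induced-orbit m = go m (<-wellFounded m)
    where
    go : ∀ m → Acc _<_ m → ∀ {y y′} → iter m π (embed y) ≡ embed y′ → ∃ λ k → iter k induced y ≡ y′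
    go zero _ e = 0 , embed-injective e
    go (suc m) (acc smaller) {y} {y′} e with <-cmp (suc m) (steps (induced-return y))
    ... | tri< lt _ _ = contradiction (subst P (sym e) (embed-∈ y′)) (avoids (induced-return y) _ (s≤s z≤n) lt)
    ... | tri≈ _ eq _ =
      1 , embed-injective (trans (induced-image y) (trans (cong (λ t → iter t π (embed y)) (sym eq)) e))
    ... | tri> _ _ gt =
      let j = steps (induced-return y)
          rest : iter (suc m ∸ j) π (embed (induced y)) ≡ embed y′
          rest = begin
            iter (suc m ∸ j) π (embed (induced y))     ≡⟨ cong (iter (suc m ∸ j) π) (induced-image y) ⟩
            iter (suc m ∸ j) π (iter j π (embed y))    ≡⟨ iter-+ (suc m ∸ j) j π (embed y) ⟨
            iter (suc m ∸ j + j) π (embed y)           ≡⟨ cong (λ t → iter t π (embed y)) (m∸n+n≡m (<⇒≤ gt)) ⟩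
            iter (suc m) π (embed y)                   ≡⟨ e ⟩
            embed y′                                   ∎
          k , eₖ = go (suc m ∸ j) (smaller (∸-monoʳ-< (steps>0 (induced-return y)) (<⇒≤ gt))) rest
      in suc k , trans (iter-sucʳ k induced y) eₖ
      where open ≡-Reasoning

  induced-iter-orbit : ∀ k y → ∃ λ m → iter m π (embed y) ≡ embed (iter k induced y)
  induced-iter-orbit zero    y = 0 , refl
  induced-iter-orbit (suc k) y =
    let m , e = induced-iter-orbit k y
        z = iter k induced y
        j = steps (induced-return z)
    in j + m , trans (iter-+ j m π (embed y)) (trans (cong (iter j π) e) (sym (induced-image z)))

module MapFacts (M : Map) (isMap : IsMap M) where
  open IsMap isMap

  σ-injective : Injective _≡_ _≡_ (σf M)
  σ-injective = Injection.injective (↔⇒↣ (σ M))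

  α-injective : Injective _≡_ _≡_ (αf M)
  α-injective {x} {y} e = trans (sym (α-invol x)) (trans (cong (αf M) e) (α-invol y))

  φ-injective : Injective _≡_ _≡_ (φf M)
  φ-injective = α-injective ∘ σ-injective

  φ-α : ∀ x → φf M (αf M x) ≡ σf M x
  φ-α x = cong (σf M) (α-invol x)

  vert-σ : ∀ x → vert M (σf M x) ≡ vert M x
  vert-σ x = vert-orb₂ x 1

  vert-φ : ∀ x → vert M (φf M x) ≡ vert M (αf M x)
  vert-φ x = vert-σ (αf M x)

  σ-returns : ∀ x → ∃ λ m → iter (suc m) (σf M) x ≡ x
  σ-returns x = let m , e = vert-orb₁ x σ⁻¹x (trans (cong (vert M) (sym (inverseʳ (σ M)))) (vert-σ σ⁻¹x))
                 in m , trans (cong (σf M) e) (inverseʳ (σ M))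
    where σ⁻¹x = σ M ⟨$⟩ˡ x

module Triangulation (M : Map) (isMap : IsMap M) (triangular : ∀ f → faceSize M f ≡ 3) where
  open IsMap isMap
  open MapFacts M isMap

  private
    D : Set
    D = Fin (nD M)
    φ : D → D
    φ = φf M

  sameFace? : ∀ x → Decidable (λ y → face M y ≡ face M x)
  sameFace? x y = face M y ≟ face M x

  face-size : ∀ x → count (sameFace? x) ≡ 3
  face-size x = trans (sym (countFibre≡count (face M) (face M x))) (triangular (face M x))

  face-closed : (S : D → Set) → (∀ {y} → S y → S (φ y)) → ∀ {x} → S x → ∀ y → face M y ≡ face M x → S y
  face-closed S closed {x} Sx y same = let j , e = face-orb₁ x y (sym same) in
    subst S e (iter-preserves S closed Sx j)

  φ≢id : ∀ x → φ x ≢ x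
  φ≢id x φx≡x = contradiction (subst (_≤ 1) (face-size x) (count-≤-cover (sameFace? x) (x ∷ []) cover))
                              λ { (s≤s ()) }
    where
    cover : ∀ y → face M y ≡ face M x → ∃ λ i → (x ∷ []) i ≡ y
    cover y same = 0F , sym (face-closed (_≡ x) (λ y≡x → trans (cong φ y≡x) φx≡x) refl y same)

  φ²≢id : ∀ x → φ (φ x) ≢ x
  φ²≢id x φ²x≡x =
    contradiction (subst (_≤ 2) (face-size x) (count-≤-cover (sameFace? x) (x ∷ φ x ∷ []) cover)) λ { (s≤s (s≤s ())) }
    where
    S : D → Set
    S y = y ≡ x ⊎ y ≡ φ x
    closed : ∀ {y} → S y → S (φ y)
    closed (inj₁ y≡x)  = inj₂ (cong φ y≡x)
    closed (inj₂ y≡φx) = inj₁ (trans (cong φ y≡φx) φ²x≡x)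
    cover : ∀ y → face M y ≡ face M x → ∃ λ i → (x ∷ φ x ∷ []) i ≡ y
    cover y same with face-closed S closed (inj₁ refl) y same
    ... | inj₁ y≡x  = 0F , sym y≡x
    ... | inj₂ y≡φx = suc 0F , sym y≡φx

  face-triple : D → Vector D 3
  face-triple x = x ∷ φ x ∷ φ (φ x) ∷ []

  face-triple-injective : ∀ x → Injective _≡_ _≡_ (face-triple x)
  face-triple-injective x = ∷-injective (∷-injective (∷-injective []-injective λ ()) fresh₁) fresh₀
    where
    fresh₁ : ∀ i → (φ (φ x) ∷ []) i ≢ φ x
    fresh₁ 0F = φ≢id x ∘ φ-injective
    fresh₀ : ∀ i → (φ x ∷ φ (φ x) ∷ []) i ≢ x
    fresh₀ 0F       = φ≢id x
    fresh₀ 1F = φ²≢id x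

  face-triple-face : ∀ x i → face M (face-triple x i) ≡ face M x
  face-triple-face x 0F             = refl
  face-triple-face x 1F       = face-orb₂ x 1
  face-triple-face x 2F = face-orb₂ x 2

  face-darts : ∀ x y → face M y ≡ face M x → ∃ λ i → face-triple x i ≡ y
  face-darts x = count-image (sameFace? x) (face-size x) (face-triple x) (face-triple-injective x)
                             (face-triple-face x)

  φ³≡id : ∀ x → φ (φ (φ x)) ≡ x
  φ³≡id x with face-darts x (φ (φ (φ x))) (face-orb₂ x 3)
  ... | 0F , e             = sym e
  ... | suc 0F , e         = contradiction (φ-injective (sym e)) (φ²≢id x)
  ... | suc 1F , e   = contradiction (φ-injective (φ-injective (sym e))) (φ≢id x)

  φ²∘σ≡α : ∀ w → φ (φ (σf M w)) ≡ αf M w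
  φ²∘σ≡α w = trans (cong (φ ∘ φ) (sym (φ-α w))) (φ³≡id (αf M w))

  darts≡3*faces : nD M ≡ 3 * nF M
  darts≡3*faces = fibres-of-size (face M) 3 triangular

  plane⇒2*vertices : IsPlane M → 2 * nV M ≡ 4 + nF M
  plane⇒2*vertices euler = +-cancelʳ-≡ (2 * nF M) _ _ (begin
    2 * nV M + 2 * nF M   ≡⟨ distrib (nV M) (nF M) ⟩
    2 * (nV M + nF M)     ≡⟨ euler ⟩
    4 + nD M              ≡⟨ cong (4 +_) darts≡3*faces ⟩
    4 + 3 * nF M          ≡⟨ regroup (nF M) ⟩
    4 + nF M + 2 * nF M   ∎)
    where
    open ≡-Reasoning
    distrib : ∀ v f → 2 * v + 2 * f ≡ 2 * (v + f)
    distrib = solve-∀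
    regroup : ∀ f → 4 + 3 * f ≡ 4 + f + 2 * f
    regroup = solve-∀

  module ProperColouring (c : Fin (nV M) → Fin 3) (proper : ∀ x → c (vert M x) ≢ c (vert M (αf M x))) where

    colour : D → Fin 3
    colour x = c (vert M x)

    colour-φ : ∀ x → colour (φ x) ≢ colour x
    colour-φ x e = proper x (trans (sym e) (cong c (vert-φ x)))

    colour-φφ : ∀ x → colour x ≢ colour (φ (φ x))
    colour-φφ x e = colour-φ (φ (φ x)) (trans (cong colour (φ³≡id x)) e)

    corner-colours : D → Vector (Fin 3) 3
    corner-colours x = colour x ∷ colour (φ x) ∷ colour (φ (φ x)) ∷ []

    corner-colours-face-triple : ∀ x i → corner-colours x i ≡ colour (face-triple x i)
    corner-colours-face-triple x 0F             = refl
    corner-colours-face-triple x 1F       = refl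
    corner-colours-face-triple x 2F = refl

    corner-colours-injective : ∀ x → Injective _≡_ _≡_ (corner-colours x)
    corner-colours-injective x = ∷-injective (∷-injective (∷-injective []-injective λ ()) fresh₁) fresh₀
      where
      fresh₁ : ∀ i → (colour (φ (φ x)) ∷ []) i ≢ colour (φ x)
      fresh₁ 0F = colour-φ (φ x)
      fresh₀ : ∀ i → (colour (φ x) ∷ colour (φ (φ x)) ∷ []) i ≢ colour x
      fresh₀ 0F       = colour-φ x
      fresh₀ 1F = colour-φφ x ∘ sym

    colour-index : ∀ x k → ∃ λ i → corner-colours x i ≡ k
    colour-index x = injective⇒surjective (corner-colours x) (corner-colours-injective x)

    third-colour : ∀ {k} x → colour x ≢ k → colour (φ x) ≢ k → colour (φ (φ x)) ≡ k
    third-colour {k} x ≢k φ≢k with colour-index x k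
    ... | 0F , e             = contradiction e ≢k
    ... | suc 0F , e         = contradiction e φ≢k
    ... | suc 1F , e   = e

    corner : Fin 3 → D → D
    corner k x = face-triple x (proj₁ (colour-index x k))

    corner-colour : ∀ k x → colour (corner k x) ≡ k
    corner-colour k x = let i , e = colour-index x k in trans (sym (corner-colours-face-triple x i)) e

    corner-face : ∀ k x → face M (corner k x) ≡ face M x
    corner-face k x = face-triple-face x (proj₁ (colour-index x k))

    corner-unique : ∀ {k x y} → face M y ≡ face M x → colour y ≡ k → y ≡ corner k x
    corner-unique {k} {x} {y} same colour≡k =
      let i , eᵢ = face-darts x y same
          j , eⱼ = colour-index x k
          i≡j : i ≡ j
          i≡j = corner-colours-injective x
                  (trans (corner-colours-face-triple x i) (trans (cong colour eᵢ) (trans colour≡k (sym eⱼ))))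
      in trans (sym eᵢ) (cong (face-triple x) i≡j)

    -- Each face has exactly one corner of each colour.
    count-colour : ∀ k → count (λ x → colour x ≟ k) ≡ nF M
    count-colour k = count-≡ (λ x → colour x ≟ k) g g-injective (λ f → corner-colour k (rep f)) cover
      where
      rep : Fin (nF M) → D
      rep f = proj₁ (face-surj f)
      g : Vector D (nF M)
      g f = corner k (rep f)
      g-face : ∀ f → face M (g f) ≡ f
      g-face f = trans (corner-face k (rep f)) (proj₂ (face-surj f))
      g-injective : Injective _≡_ _≡_ g
      g-injective {f} {f′} e = trans (sym (g-face f)) (trans (cong (face M) e) (g-face f′))
      cover : ∀ x → colour x ≡ k → ∃ λ f → g f ≡ x
      cover x colour≡k = face M x , sym (corner-unique (sym (proj₂ (face-surj (face M x)))) colour≡k)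

QuadrangularPredecoration : (O : Map) → (Fin (nV O) → Fin 3) → Fin (nV O) → ℕ → Set
QuadrangularPredecoration O c v₁ n = Σ Map λ Q → Σ (Fin (nD Q) → Fin (nD O)) λ ι →
  IsPredecorationVia O c v₁ Q ι × IsPlaneQuadrangulation Q × 2 * nV Q ≡ n

module Predecoration (O : Map) (c : Fin (nV O) → Fin 3) (v₀ v₁ v₂ : Fin (nV O))
                     (lopsp : IsLopsp O c v₀ v₁ v₂) where
  open IsLopsp lopsp
  private
    isMap : IsMap O
    isMap = proj₁ triang
  open IsMap isMap
  open MapFacts O isMap
  open Triangulation O isMap (proj₂ (proj₂ triang))
  open ProperColouring c proper

  private
    D V : Set
    D = Fin (nD O)
    V = Fin (nV O)
    σₒ αₒ φₒ : D → D
    σₒ = σf O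
    αₒ = αf O
    φₒ = φf O
    vertₒ : D → V
    vertₒ = vert O

  col1≢col2 : col1 ≢ col2
  col1≢col2 ()

  colour-α : ∀ x → colour (αₒ x) ≡ colour (φₒ x)
  colour-α x = cong c (sym (vert-φ x))

  ColourOneEdge : D → Set
  ColourOneEdge x = colour x ≢ col1 × colour (αₒ x) ≢ col1

  colourOneEdge? : Decidable ColourOneEdge
  colourOneEdge? x = ¬? (colour x ≟ col1) ×-dec ¬? (colour (αₒ x) ≟ col1)

  colourOneEdge⇒apex : ∀ {x} → ColourOneEdge x → colour (φₒ (φₒ x)) ≡ col1
  colourOneEdge⇒apex {x} (x≢1 , αx≢1) = third-colour x x≢1 (αx≢1 ∘ trans (colour-α x))

  apex⇒colourOneEdge : ∀ {x} → colour (φₒ (φₒ x)) ≡ col1 → ColourOneEdge x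
  apex⇒colourOneEdge {x} apex =
    (λ e → colour-φφ x (trans e (sym apex))) ,
    (λ e → colour-φ (φₒ x) (trans apex (sym (trans (sym (colour-α x)) e))))

  V₁Edge : D → Set
  V₁Edge x = c v₁ ≡ col1 × (vertₒ x ≡ v₁ ⊎ vertₒ (αₒ x) ≡ v₁) × colour x ≢ col2 × colour (αₒ x) ≢ col2

  v₁Edge? : Decidable V₁Edge
  v₁Edge? x = (c v₁ ≟ col1) ×-dec ((vertₒ x ≟ v₁ ⊎-dec vertₒ (αₒ x) ≟ v₁)
                                   ×-dec (¬? (colour x ≟ col2) ×-dec ¬? (colour (αₒ x) ≟ col2)))

  Kept : D → Set
  Kept = InQ O c v₁

  kept? : Decidable Kept
  kept? x = colourOneEdge? x ⊎-dec v₁Edge? x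

  kept-α : ∀ {x} → Kept x → Kept (αₒ x)
  kept-α {x} (inj₁ (x≢1 , αx≢1)) = inj₁ (αx≢1 , subst (λ t → colour t ≢ col1) (sym (α-invol x)) x≢1)
  kept-α {x} (inj₂ (v₁≡1 , at-v₁ , x≢2 , αx≢2)) =
    inj₂ (v₁≡1 , swap at-v₁ , αx≢2 , subst (λ t → colour t ≢ col2) (sym (α-invol x)) x≢2)
    where
    swap : vertₒ x ≡ v₁ ⊎ vertₒ (αₒ x) ≡ v₁ → vertₒ (αₒ x) ≡ v₁ ⊎ vertₒ (αₒ (αₒ x)) ≡ v₁
    swap (inj₁ e) = inj₂ (trans (cong vertₒ (α-invol x)) e)
    swap (inj₂ e) = inj₁ e

  module Darts = Enumeration (enumerate kept?)

  DQ : Set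
  DQ = Fin (count kept?)

  ι : DQ → D
  ι = Darts.embed

  opaque
    αQ : DQ → DQ
    αQ y = Darts.index (αₒ (ι y)) (kept-α (Darts.embed-∈ y))

    ι-αQ : ∀ y → ι (αQ y) ≡ αₒ (ι y)
    ι-αQ y = Darts.embed-index _ _

  αQ-involutive : ∀ y → αQ (αQ y) ≡ y
  αQ-involutive y = Darts.embed-injective (trans (ι-αQ (αQ y)) (trans (cong αₒ (ι-αQ y)) (α-invol (ι y))))

  open FirstReturn σₒ σ-injective σ-returns kept?
    using ( Return; induced-return; induced-image; embed-induced-next; embed-induced-skip; induced-injective
          ; induced-orbit; induced-iter-orbit )
    renaming (induced to σQ)

  QVertex : V → Set
  QVertex v = c v ≢ col1 ⊎ (v ≡ v₁ × c v₁ ≡ col1)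

  qVertex? : Decidable QVertex
  qVertex? v = ¬? (c v ≟ col1) ⊎-dec ((v ≟ v₁) ×-dec (c v₁ ≟ col1))

  kept⇒qVertex : ∀ x → Kept x → QVertex (vertₒ x)
  kept⇒qVertex x (inj₁ (x≢1 , _))               = inj₁ x≢1
  kept⇒qVertex x (inj₂ (v₁≡1 , inj₁ x-at-v₁ , _)) = inj₂ (x-at-v₁ , v₁≡1)
  kept⇒qVertex x (inj₂ (v₁≡1 , inj₂ αx-at-v₁ , _)) =
    inj₁ (λ x≡1 → proper x (trans x≡1 (sym (trans (cong c αx-at-v₁) v₁≡1))))

  -- The dart at the vertex of z along the other side of the face of z.
  flank : D → D
  flank z = αₒ (φₒ (φₒ z))

  flank-vert : ∀ z → vertₒ (flank z) ≡ vertₒ z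
  flank-vert z = trans (sym (vert-φ (φₒ (φₒ z)))) (cong vertₒ (φ³≡id z))

  flank-end : ∀ z → colour (αₒ (flank z)) ≡ colour (φₒ (φₒ z))
  flank-end z = cong colour (α-invol _)

  some-side-avoids : ∀ k z → ∃ λ x → vertₒ x ≡ vertₒ z × colour (αₒ x) ≢ k
  some-side-avoids k z with colour (φₒ z) ≟ k
  ... | no φz≢k  = z , refl , φz≢k ∘ trans (sym (colour-α z))
  ... | yes φz≡k = flank z , flank-vert z ,
                   λ e → colour-φ (φₒ z) (trans (sym (flank-end z)) (trans e (sym φz≡k)))

  qVertex⇒kept : ∀ v → QVertex v → ∃ λ x → Kept x × vertₒ x ≡ v
  qVertex⇒kept v q = let z , z-at-v = vert-surj v in by-kind z z-at-v q
    where
    by-kind : ∀ z → vertₒ z ≡ v → QVertex v → ∃ λ x → Kept x × vertₒ x ≡ v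
    by-kind z z-at-v (inj₁ v≢1) =
      let x , x-at-z , αx≢1 = some-side-avoids col1 z
          x-at-v = trans x-at-z z-at-v
      in x , inj₁ (v≢1 ∘ trans (cong c (sym x-at-v)) , αx≢1) , x-at-v
    by-kind z z-at-v (inj₂ (refl , v₁≡1)) =
      let x , x-at-z , αx≢2 = some-side-avoids col2 z
          x-at-v = trans x-at-z z-at-v
          x≢2 = col1≢col2 ∘ trans (sym v₁≡1) ∘ trans (cong c (sym x-at-v))
      in x , inj₂ (v₁≡1 , inj₁ x-at-v , x≢2 , αx≢2) , x-at-v

  module QVertices = Enumeration (enumerate qVertex?)

  vertQ : DQ → Fin (count qVertex?)
  vertQ y = QVertices.index (vertₒ (ι y)) (kept⇒qVertex _ (Darts.embed-∈ y))

  vertQ-embed : ∀ y → QVertices.embed (vertQ y) ≡ vertₒ (ι y)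
  vertQ-embed y = QVertices.embed-index _ _

  vertₒ-σQ-iter : ∀ k y → vertₒ (ι (iter k σQ y)) ≡ vertₒ (ι y)
  vertₒ-σQ-iter k y = let m , e = induced-iter-orbit k y in trans (cong vertₒ (sym e)) (vert-orb₂ (ι y) m)

  same-vertₒ⇒σQ-orbit : ∀ y y′ → vertₒ (ι y) ≡ vertₒ (ι y′) → ∃ λ k → iter k σQ y ≡ y′
  same-vertₒ⇒σQ-orbit y y′ e = let m , eₘ = vert-orb₁ (ι y) (ι y′) e in induced-orbit m eₘ

  colourOne? : Decidable (λ v → c v ≡ col1)
  colourOne? v = c v ≟ col1

  module Centres = Enumeration (enumerate colourOne?)

  n₁ : ℕ
  n₁ = count colourOne?

  -- The face of Q containing a kept dart is the quadrangle around a colour-1 vertex, its centre.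
  centreOf : ∀ x → Dec (ColourOneEdge x) → V
  centreOf x (yes _) = vertₒ (φₒ (φₒ x))
  centreOf x (no _)  = v₁

  centre : DQ → V
  centre y = centreOf (ι y) (colourOneEdge? (ι y))

  centre-edge : ∀ y → ColourOneEdge (ι y) → centre y ≡ vertₒ (φₒ (φₒ (ι y)))
  centre-edge y edge with colourOneEdge? (ι y)
  ... | yes _    = refl
  ... | no ¬edge = contradiction edge ¬edge

  centre-not-edge : ∀ y → ¬ ColourOneEdge (ι y) → centre y ≡ v₁
  centre-not-edge y ¬edge with colourOneEdge? (ι y)
  ... | yes edge = contradiction edge ¬edge
  ... | no _     = refl

  not-edge⇒v₁Edge : ∀ y → ¬ ColourOneEdge (ι y) → V₁Edge (ι y)
  not-edge⇒v₁Edge y ¬edge with Darts.embed-∈ y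
  ... | inj₁ edge    = contradiction edge ¬edge
  ... | inj₂ v₁-edge = v₁-edge

  centre-colour : ∀ y → c (centre y) ≡ col1
  centre-colour y with colourOneEdge? (ι y)
  ... | yes edge = colourOneEdge⇒apex edge
  ... | no ¬edge = proj₁ (not-edge⇒v₁Edge y ¬edge)

  faceQ : DQ → Fin n₁
  faceQ y = Centres.index (centre y) (centre-colour y)

  faceQ-embed : ∀ y → Centres.embed (faceQ y) ≡ centre y
  faceQ-embed y = Centres.embed-index _ _

  faceQ-≡ : ∀ y f → centre y ≡ Centres.embed f → faceQ y ≡ f
  faceQ-≡ y f e = Centres.embed-injective (trans (faceQ-embed y) e)

  faceQ⇒centre : ∀ y f → faceQ y ≡ f → centre y ≡ Centres.embed f
  faceQ⇒centre y f e = trans (sym (faceQ-embed y)) (cong Centres.embed e)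

  φQ : DQ → DQ
  φQ y = σQ (αQ y)

  φQ-next : ∀ y {x w} → ι y ≡ x → φₒ x ≡ w → Kept w → ι (φQ y) ≡ w
  φQ-next y refl refl kept = trans (embed-induced-next (αQ y) (subst (Kept ∘ σₒ) (sym (ι-αQ y)) kept))
                                     (cong σₒ (ι-αQ y))

  φQ-skip : ∀ y {x w} → ι y ≡ x → φₒ x ≡ w → ¬ Kept w → Kept (σₒ w) → ι (φQ y) ≡ σₒ w
  φQ-skip y refl refl ¬kept kept =
    trans (embed-induced-skip (αQ y) (subst (¬_ ∘ Kept ∘ σₒ) (sym (ι-αQ y)) ¬kept)
                                     (subst (Kept ∘ σₒ ∘ σₒ) (sym (ι-αQ y)) kept))
          (cong (σₒ ∘ σₒ) (ι-αQ y))

  φ-edge : ∀ {z} → colour z ≡ col1 → ColourOneEdge (φₒ z)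
  φ-edge {z} z≡1 = apex⇒colourOneEdge (trans (cong colour (φ³≡id z)) z≡1)

  spoke : ∀ z → colour z ≡ col1 → DQ
  spoke z z≡1 = Darts.index (φₒ z) (inj₁ (φ-edge z≡1))

  ι-spoke : ∀ z z≡1 → ι (spoke z z≡1) ≡ φₒ z
  ι-spoke z z≡1 = Darts.embed-index _ _

  centre-spoke : ∀ z z≡1 → centre (spoke z z≡1) ≡ vertₒ z
  centre-spoke z z≡1 = trans (centre-edge _ (subst ColourOneEdge (sym (ι-spoke z z≡1)) (φ-edge z≡1)))
                             (cong vertₒ (trans (cong (φₒ ∘ φₒ) (ι-spoke z z≡1)) (φ³≡id z)))

  module AwayFromV₁ {y} (centre≢v₁ : centre y ≢ v₁) where
    edge : ColourOneEdge (ι y)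
    edge = decidable-stable (colourOneEdge? (ι y)) (centre≢v₁ ∘ centre-not-edge y)

    apex≢v₁ : vertₒ (φₒ (φₒ (ι y))) ≢ v₁
    apex≢v₁ = centre≢v₁ ∘ trans (centre-edge y edge)

    φ-not-kept : ¬ Kept (φₒ (ι y))
    φ-not-kept (inj₁ (_ , αφ≢1)) = αφ≢1 (trans (colour-α (φₒ (ι y))) (colourOneEdge⇒apex edge))
    φ-not-kept (inj₂ (v₁≡1 , inj₁ φ-at-v₁ , _)) =
      proj₂ edge (trans (colour-α (ι y)) (trans (cong c φ-at-v₁) v₁≡1))
    φ-not-kept (inj₂ (_ , inj₂ αφ-at-v₁ , _)) = apex≢v₁ (trans (vert-φ (φₒ (ι y))) αφ-at-v₁)

    σφ-edge : ColourOneEdge (σₒ (φₒ (ι y)))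
    σφ-edge = apex⇒colourOneEdge
      (trans (cong colour (φ²∘σ≡α _)) (trans (colour-α _) (colourOneEdge⇒apex edge)))

    ι-φQ : ι (φQ y) ≡ σₒ (φₒ (ι y))
    ι-φQ = φQ-skip y refl refl φ-not-kept (inj₁ σφ-edge)

    apex-φQ : φₒ (φₒ (ι (φQ y))) ≡ αₒ (φₒ (ι y))
    apex-φQ = trans (cong (φₒ ∘ φₒ) ι-φQ) (φ²∘σ≡α _)

    centre-φQ : centre (φQ y) ≡ centre y
    centre-φQ = begin
      centre (φQ y)                    ≡⟨ centre-edge (φQ y) (subst ColourOneEdge (sym ι-φQ) σφ-edge) ⟩
      vertₒ (φₒ (φₒ (ι (φQ y))))       ≡⟨ cong vertₒ apex-φQ ⟩
      vertₒ (αₒ (φₒ (ι y)))            ≡⟨ vert-φ _ ⟨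
      vertₒ (φₒ (φₒ (ι y)))            ≡⟨ centre-edge y edge ⟨
      centre y                         ∎
      where open ≡-Reasoning

    -- Each step of φQ turns the corner at the centre back by one step of σ.
    σ-apex-φQ : σₒ (φₒ (φₒ (ι (φQ y)))) ≡ φₒ (φₒ (ι y))
    σ-apex-φQ = cong σₒ apex-φQ

  col0≢col2 : col0 ≢ col2
  col0≢col2 ()

  neither-one-nor-two : ∀ (k : Fin 3) → k ≢ col1 → k ≢ col2 → k ≡ col0
  neither-one-nor-two 0F _  _  = refl
  neither-one-nor-two 1F ≢1 _  = contradiction refl ≢1
  neither-one-nor-two 2F _  ≢2 = contradiction refl ≢2

  -- v₁ has degree 2: its darts a and b = σ a lie in two triangles whose sides φ a and φ b opposite v₁,
  -- followed by the edge of colour 2 at v₁ traversed both ways, bound one quadrangle of Q.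
  module AroundV₁ (v₁≡1 : c v₁ ≡ col1) where
    private
      start : ∃ λ x → Kept x × vertₒ x ≡ v₁
      start = qVertex⇒kept v₁ (inj₂ (refl , v₁≡1))

    a b : D
    a = proj₁ start
    b = σₒ a

    a-kept : Kept a
    a-kept = proj₁ (proj₂ start)

    a-at-v₁ : vertₒ a ≡ v₁
    a-at-v₁ = proj₂ (proj₂ start)

    b-at-v₁ : vertₒ b ≡ v₁
    b-at-v₁ = trans (vert-σ a) a-at-v₁

    colour-a : colour a ≡ col1
    colour-a = trans (cong c a-at-v₁) v₁≡1

    colour-b : colour b ≡ col1
    colour-b = trans (cong c b-at-v₁) v₁≡1

    colour-αa : colour (αₒ a) ≡ col0
    colour-αa with a-kept
    ... | inj₁ (a≢1 , _)          = contradiction colour-a a≢1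
    ... | inj₂ (_ , _ , _ , αa≢2) = neither-one-nor-two _ (λ e → proper a (trans colour-a (sym e))) αa≢2

    colour-αb : colour (αₒ b) ≡ col2
    colour-αb = trans (colour-α b) (trans (cong (colour ∘ φₒ) (sym (φ-α a)))
                  (third-colour (αₒ a) (col0≢col2 ∘ trans (sym colour-αa))
                                       (col1≢col2 ∘ trans (sym (trans (cong colour (φ-α a)) colour-b)))))

    a≢b : a ≢ b
    a≢b e = col0≢col2 (trans (sym colour-αa) (trans (cong (colour ∘ αₒ) e) colour-αb))

    private
      ab-injective : Injective _≡_ _≡_ (a ∷ b ∷ [])
      ab-injective = ∷-injective (∷-injective []-injective λ ()) λ { 0F → a≢b ∘ sym }

    darts-at-v₁ : ∀ x → vertₒ x ≡ v₁ → x ≡ a ⊎ x ≡ b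
    darts-at-v₁ x x-at-v₁
      with count-image (λ z → vertₒ z ≟ v₁) (trans (sym (countFibre≡count vertₒ v₁)) (v₁-deg v₁≡1))
                       (a ∷ b ∷ []) ab-injective (λ { 0F → a-at-v₁ ; 1F → b-at-v₁ }) x x-at-v₁
    ... | 0F , e     = inj₁ (sym e)
    ... | 1F , e = inj₂ (sym e)

    σb≡a : σₒ b ≡ a
    σb≡a with darts-at-v₁ (σₒ b) (trans (vert-σ b) b-at-v₁)
    ... | inj₁ e = e
    ... | inj₂ e = contradiction (σ-injective (sym e)) a≢b

    b-not-kept : ¬ Kept b
    b-not-kept (inj₁ (b≢1 , _))          = b≢1 colour-b
    b-not-kept (inj₂ (_ , _ , _ , αb≢2)) = αb≢2 colour-αb

    αb-not-kept : ¬ Kept (αₒ b)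
    αb-not-kept (inj₁ (_ , ααb≢1))       = ααb≢1 (trans (cong colour (α-invol b)) colour-b)
    αb-not-kept (inj₂ (_ , _ , αb≢2 , _)) = αb≢2 colour-αb

    a-not-edge : ¬ ColourOneEdge a
    a-not-edge (a≢1 , _) = a≢1 colour-a

    αa-not-edge : ¬ ColourOneEdge (αₒ a)
    αa-not-edge (_ , ααa≢1) = ααa≢1 (trans (cong colour (α-invol a)) colour-a)

    square : Vector D 4
    square = φₒ a ∷ φₒ b ∷ αₒ a ∷ a ∷ []

    square-kept : ∀ i → Kept (square i)
    square-kept 0F = inj₁ (φ-edge colour-a)
    square-kept 1F = inj₁ (φ-edge colour-b)
    square-kept 2F = kept-α a-kept
    square-kept 3F = a-kept

    square-injective : Injective _≡_ _≡_ square
    square-injective = ∷-injective (∷-injective (∷-injective (∷-injective []-injective λ ()) fresh₂) fresh₁) fresh₀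
      where
      edge-at : ∀ {x x′} → ColourOneEdge x′ → x ≡ x′ → ColourOneEdge x
      edge-at edge e = subst ColourOneEdge (sym e) edge
      fresh₂ : ∀ i → (a ∷ []) i ≢ αₒ a
      fresh₂ 0F = α-nofix a ∘ sym
      fresh₁ : ∀ i → (αₒ a ∷ a ∷ []) i ≢ φₒ b
      fresh₁ 0F = αa-not-edge ∘ edge-at (φ-edge colour-b)
      fresh₁ 1F = a-not-edge ∘ edge-at (φ-edge colour-b)
      fresh₀ : ∀ i → (φₒ b ∷ αₒ a ∷ a ∷ []) i ≢ φₒ a
      fresh₀ 0F e = col0≢col2 (trans (sym colour-αa) (trans (colour-α a) (trans (cong colour (sym e))
                                 (trans (sym (colour-α b)) colour-αb))))
      fresh₀ 1F = αa-not-edge ∘ edge-at (φ-edge colour-a)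
      fresh₀ 2F = a-not-edge ∘ edge-at (φ-edge colour-a)

    ŷ : Vector DQ 4
    ŷ i = Darts.index (square i) (square-kept i)

    ι-ŷ : ∀ i → ι (ŷ i) ≡ square i
    ι-ŷ i = Darts.embed-index _ _

    ŷ-injective : Injective _≡_ _≡_ ŷ
    ŷ-injective {i} {j} e = square-injective (trans (sym (ι-ŷ i)) (trans (cong ι e) (ι-ŷ j)))

    private
      ŷ-≡ : ∀ y i → ι y ≡ square i → y ≡ ŷ i
      ŷ-≡ y i e = Darts.embed-injective (trans e (sym (ι-ŷ i)))

      φφa≡αb : φₒ (φₒ a) ≡ αₒ b
      φφa≡αb = trans (cong (φₒ ∘ φₒ) (sym σb≡a)) (φ²∘σ≡α b)

    φQ-ŷ₀ : φQ (ŷ 0F) ≡ ŷ 1F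
    φQ-ŷ₀ = ŷ-≡ (φQ (ŷ 0F)) 1F (φQ-skip (ŷ 0F) (ι-ŷ 0F) φφa≡αb αb-not-kept (square-kept 1F))

    φQ-ŷ₁ : φQ (ŷ 1F) ≡ ŷ 2F
    φQ-ŷ₁ = ŷ-≡ (φQ (ŷ 1F)) 2F (φQ-next (ŷ 1F) (ι-ŷ 1F) (φ²∘σ≡α a) (square-kept 2F))

    φQ-ŷ₂ : φQ (ŷ 2F) ≡ ŷ 3F
    φQ-ŷ₂ = ŷ-≡ (φQ (ŷ 2F)) 3F
      (trans (φQ-skip (ŷ 2F) (ι-ŷ 2F) (φ-α a) b-not-kept (subst Kept (sym σb≡a) a-kept)) σb≡a)

    φQ-ŷ₃ : φQ (ŷ 3F) ≡ ŷ 0F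
    φQ-ŷ₃ = ŷ-≡ (φQ (ŷ 3F)) 0F (φQ-next (ŷ 3F) (ι-ŷ 3F) refl (square-kept 0F))

    centre-ŷ : ∀ i → centre (ŷ i) ≡ v₁
    centre-ŷ 0F = trans (centre-edge (ŷ 0F) (subst ColourOneEdge (sym (ι-ŷ 0F)) (φ-edge colour-a)))
                        (trans (cong (vertₒ ∘ φₒ ∘ φₒ) (ι-ŷ 0F)) (trans (cong vertₒ (φ³≡id a)) a-at-v₁))
    centre-ŷ 1F = trans (centre-edge (ŷ 1F) (subst ColourOneEdge (sym (ι-ŷ 1F)) (φ-edge colour-b)))
                        (trans (cong (vertₒ ∘ φₒ ∘ φₒ) (ι-ŷ 1F)) (trans (cong vertₒ (φ³≡id b)) b-at-v₁))
    centre-ŷ 2F = centre-not-edge _ (αa-not-edge ∘ subst ColourOneEdge (ι-ŷ 2F))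
    centre-ŷ 3F = centre-not-edge _ (a-not-edge ∘ subst ColourOneEdge (ι-ŷ 3F))

    square-complete : ∀ y → centre y ≡ v₁ → ∃ λ i → ŷ i ≡ y
    square-complete y at-v₁ = by-kind (colourOneEdge? (ι y))
      where
      kept : Kept (ι y)
      kept = Darts.embed-∈ y
      opposite-case : φₒ (φₒ (ι y)) ≡ a ⊎ φₒ (φₒ (ι y)) ≡ b → ∃ λ i → ŷ i ≡ y
      opposite-case (inj₁ e) = 0F , sym (ŷ-≡ y 0F (trans (sym (φ³≡id (ι y))) (cong φₒ e)))
      opposite-case (inj₂ e) = 1F , sym (ŷ-≡ y 1F (trans (sym (φ³≡id (ι y))) (cong φₒ e)))
      spoke-case : vertₒ (ι y) ≡ v₁ ⊎ vertₒ (αₒ (ι y)) ≡ v₁ → ∃ λ i → ŷ i ≡ y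
      spoke-case (inj₁ y-at-v₁) with darts-at-v₁ _ y-at-v₁
      ... | inj₁ e = 3F , sym (ŷ-≡ y 3F e)
      ... | inj₂ e = contradiction (subst Kept e kept) b-not-kept
      spoke-case (inj₂ αy-at-v₁) with darts-at-v₁ _ αy-at-v₁
      ... | inj₁ e = 2F , sym (ŷ-≡ y 2F (trans (sym (α-invol (ι y))) (cong αₒ e)))
      ... | inj₂ e = contradiction (subst Kept (trans (sym (α-invol (ι y))) (cong αₒ e)) kept) αb-not-kept
      by-kind : Dec (ColourOneEdge (ι y)) → ∃ λ i → ŷ i ≡ y
      by-kind (yes edge) = opposite-case (darts-at-v₁ _ (trans (sym (centre-edge y edge)) at-v₁))
      by-kind (no ¬edge) = spoke-case (proj₁ (proj₂ (not-edge⇒v₁Edge y ¬edge)))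

    centre-φQ : ∀ y → centre y ≡ v₁ → centre (φQ y) ≡ v₁
    centre-φQ y at-v₁ with square-complete y at-v₁
    ... | 0F , refl = subst (λ t → centre t ≡ v₁) (sym φQ-ŷ₀) (centre-ŷ 1F)
    ... | 1F , refl = subst (λ t → centre t ≡ v₁) (sym φQ-ŷ₁) (centre-ŷ 2F)
    ... | 2F , refl = subst (λ t → centre t ≡ v₁) (sym φQ-ŷ₂) (centre-ŷ 3F)
    ... | 3F , refl = subst (λ t → centre t ≡ v₁) (sym φQ-ŷ₃) (centre-ŷ 0F)

    ŷ-from-ŷ₀ : ∀ i → iter (toℕ i) φQ (ŷ 0F) ≡ ŷ i
    ŷ-from-ŷ₀ 0F = refl
    ŷ-from-ŷ₀ 1F = φQ-ŷ₀
    ŷ-from-ŷ₀ 2F = trans (cong φQ φQ-ŷ₀) φQ-ŷ₁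
    ŷ-from-ŷ₀ 3F = trans (cong (φQ ∘ φQ) φQ-ŷ₀) (trans (cong φQ φQ-ŷ₁) φQ-ŷ₂)

    ŷ-to-ŷ₀ : ∀ i → iter (4 ∸ toℕ i) φQ (ŷ i) ≡ ŷ 0F
    ŷ-to-ŷ₀ 0F = trans (cong (φQ ∘ φQ ∘ φQ) φQ-ŷ₀) (trans (cong (φQ ∘ φQ) φQ-ŷ₁) (trans (cong φQ φQ-ŷ₂) φQ-ŷ₃))
    ŷ-to-ŷ₀ 1F = trans (cong (φQ ∘ φQ) φQ-ŷ₁) (trans (cong φQ φQ-ŷ₂) φQ-ŷ₃)
    ŷ-to-ŷ₀ 2F = trans (cong φQ φQ-ŷ₂) φQ-ŷ₃
    ŷ-to-ŷ₀ 3F = φQ-ŷ₃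

    φQ-orbit : ∀ y y′ → centre y ≡ v₁ → centre y′ ≡ v₁ → ∃ λ k → iter k φQ y ≡ y′
    φQ-orbit y y′ y-at-v₁ y′-at-v₁ =
      let i , eᵢ = square-complete y y-at-v₁
          j , eⱼ = square-complete y′ y′-at-v₁
      in toℕ j + (4 ∸ toℕ i) , (begin
        iter (toℕ j + (4 ∸ toℕ i)) φQ y               ≡⟨ cong (iter (toℕ j + (4 ∸ toℕ i)) φQ) eᵢ ⟨
        iter (toℕ j + (4 ∸ toℕ i)) φQ (ŷ i)           ≡⟨ iter-+ (toℕ j) (4 ∸ toℕ i) φQ (ŷ i) ⟩
        iter (toℕ j) φQ (iter (4 ∸ toℕ i) φQ (ŷ i))   ≡⟨ cong (iter (toℕ j) φQ) (ŷ-to-ŷ₀ i) ⟩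
        iter (toℕ j) φQ (ŷ 0F)                        ≡⟨ ŷ-from-ŷ₀ j ⟩
        ŷ j                                           ≡⟨ eⱼ ⟩
        y′                                            ∎)
      where open ≡-Reasoning

    quadrangle-size : ∀ f → Centres.embed f ≡ v₁ → count (λ y → faceQ y ≟ f) ≡ 4
    quadrangle-size f f-at-v₁ = count-≡ (λ y → faceQ y ≟ f) ŷ ŷ-injective
      (λ i → faceQ-≡ (ŷ i) f (trans (centre-ŷ i) (sym f-at-v₁)))
      (λ y fy → square-complete y (trans (faceQ⇒centre y f fy) f-at-v₁))

  v₁-colour : ∀ {y} → centre y ≡ v₁ → c v₁ ≡ col1
  v₁-colour {y} e = trans (cong c (sym e)) (centre-colour y)

  centre-φQ : ∀ y → centre (φQ y) ≡ centre y
  centre-φQ y = by-place (centre y ≟ v₁)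
    where
    by-place : Dec (centre y ≡ v₁) → centre (φQ y) ≡ centre y
    by-place (yes at-v₁) = trans (AroundV₁.centre-φQ (v₁-colour at-v₁) y at-v₁) (sym at-v₁)
    by-place (no ≢v₁)    = AwayFromV₁.centre-φQ ≢v₁

  centre-φQ-iter : ∀ k y → centre (iter k φQ y) ≡ centre y
  centre-φQ-iter zero    y = refl
  centre-φQ-iter (suc k) y = trans (centre-φQ (iter k φQ y)) (centre-φQ-iter k y)

  σ-apex-φQ-iter : ∀ k y → centre y ≢ v₁ → iter k σₒ (φₒ (φₒ (ι (iter k φQ y)))) ≡ φₒ (φₒ (ι y))
  σ-apex-φQ-iter zero    y ≢v₁ = refl
  σ-apex-φQ-iter (suc k) y ≢v₁ = begin
    iter (suc k) σₒ (φₒ (φₒ (ι (φQ z))))  ≡⟨ iter-sucʳ k σₒ _ ⟩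
    iter k σₒ (σₒ (φₒ (φₒ (ι (φQ z)))))   ≡⟨ cong (iter k σₒ) (AwayFromV₁.σ-apex-φQ z≢v₁) ⟩
    iter k σₒ (φₒ (φₒ (ι z)))             ≡⟨ σ-apex-φQ-iter k y ≢v₁ ⟩
    φₒ (φₒ (ι y))                         ∎
    where
    open ≡-Reasoning
    z : DQ
    z = iter k φQ y
    z≢v₁ : centre z ≢ v₁
    z≢v₁ = ≢v₁ ∘ trans (sym (centre-φQ-iter k y))

  φ²-injective : Injective _≡_ _≡_ (φₒ ∘ φₒ)
  φ²-injective = φ-injective ∘ φ-injective

  φQ-orbit : ∀ y y′ → centre y ≡ centre y′ → ∃ λ k → iter k φQ y ≡ y′
  φQ-orbit y y′ same = by-place (centre y ≟ v₁)
    where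
    by-place : Dec (centre y ≡ v₁) → ∃ λ k → iter k φQ y ≡ y′
    by-place (yes at-v₁) = AroundV₁.φQ-orbit (v₁-colour at-v₁) y y′ at-v₁ (trans (sym same) at-v₁)
    by-place (no ≢v₁) =
      let same-apex-vertex = trans (sym (centre-edge y′ (AwayFromV₁.edge (≢v₁ ∘ trans same))))
                                   (trans (sym same) (centre-edge y (AwayFromV₁.edge ≢v₁)))
          m , eₘ = vert-orb₁ (φₒ (φₒ (ι y′))) (φₒ (φₒ (ι y))) same-apex-vertex
      in m , Darts.embed-injective (φ²-injective (iter-injective m σ-injective
               (trans (σ-apex-φQ-iter m y ≢v₁) (sym eₘ))))

  faceQ-surjective : ∀ f → ∃ λ y → faceQ y ≡ f
  faceQ-surjective f = let z , z-at = vert-surj (Centres.embed f)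
                           z≡1 = trans (cong c z-at) (Centres.embed-∈ f)
                       in spoke z z≡1 , faceQ-≡ _ f (trans (centre-spoke z z≡1) z-at)

  colour-one⇒≢v₀ : ∀ {v} → c v ≡ col1 → v ≢ v₀
  colour-one⇒≢v₀ v≡1 refl = v₀-col v≡1

  colour-one⇒≢v₂ : ∀ {v} → c v ≡ col1 → v ≢ v₂
  colour-one⇒≢v₂ v≡1 refl = v₂-col v≡1

  -- Away from v₁ the darts of a face of Q correspond to the four darts at its centre.
  face-size-away : ∀ f → Centres.embed f ≢ v₁ → count (λ y → faceQ y ≟ f) ≡ 4
  face-size-away f w≢v₁ = begin
    count fibre?                ≡⟨ ≤-antisym (count-≤-injection fibre? (λ z → vertₒ z ≟ w) apex apex-at apex-inj)
                                             (count-≤-injection (λ z → vertₒ z ≟ w) fibre? spoke′ spoke-face spoke-inj) ⟩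
    count (λ z → vertₒ z ≟ w)   ≡⟨ countFibre≡count vertₒ w ⟨
    deg O w                     ≡⟨ other-deg w (colour-one⇒≢v₀ w≡1) w≢v₁ (colour-one⇒≢v₂ w≡1) w≡1 ⟩
    4                           ∎
    where
    open ≡-Reasoning
    fibre? : Decidable (λ y → faceQ y ≡ f)
    fibre? y = faceQ y ≟ f
    w : V
    w = Centres.embed f
    w≡1 : c w ≡ col1
    w≡1 = Centres.embed-∈ f
    apex : ∀ y → faceQ y ≡ f → D
    apex y _ = φₒ (φₒ (ι y))
    apex-at : ∀ y fy → vertₒ (apex y fy) ≡ w
    apex-at y fy = trans (sym (centre-edge y (AwayFromV₁.edge (w≢v₁ ∘ trans (sym (faceQ⇒centre y f fy))))))
                         (faceQ⇒centre y f fy)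
    apex-inj : ∀ {y y′} p q → apex y p ≡ apex y′ q → y ≡ y′
    apex-inj _ _ e = Darts.embed-injective (φ²-injective e)
    spoke′ : ∀ z → vertₒ z ≡ w → DQ
    spoke′ z z-at = spoke z (trans (cong c z-at) w≡1)
    spoke-face : ∀ z z-at → faceQ (spoke′ z z-at) ≡ f
    spoke-face z z-at = faceQ-≡ _ f (trans (centre-spoke z (trans (cong c z-at) w≡1)) z-at)
    spoke-inj : ∀ {z z′} p q → spoke′ z p ≡ spoke′ z′ q → z ≡ z′
    spoke-inj {z} {z′} p q e = φ-injective (trans (sym (ι-spoke z (trans (cong c p) w≡1)))
                                           (trans (cong ι e) (ι-spoke z′ (trans (cong c q) w≡1))))

  faceQ-size : ∀ f → countFibre faceQ f ≡ 4
  faceQ-size f = trans (countFibre≡count faceQ f) (by-place (Centres.embed f ≟ v₁))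
    where
    by-place : Dec (Centres.embed f ≡ v₁) → count (λ y → faceQ y ≟ f) ≡ 4
    by-place (yes at-v₁) = AroundV₁.quadrangle-size (trans (cong c (sym at-v₁)) (Centres.embed-∈ f)) f at-v₁
    by-place (no ≢v₁)    = face-size-away f ≢v₁

  vertQ-surjective : ∀ v → ∃ λ y → vertQ y ≡ v
  vertQ-surjective v =
    let x , kept , x-at = qVertex⇒kept (QVertices.embed v) (QVertices.embed-∈ v)
    in Darts.index x kept ,
       QVertices.embed-injective (trans (vertQ-embed _) (trans (cong vertₒ (Darts.embed-index x kept)) x-at))

  vertQ-orbit : ∀ y y′ → vertQ y ≡ vertQ y′ → ∃ λ k → iter k σQ y ≡ y′
  vertQ-orbit y y′ e = same-vertₒ⇒σQ-orbit y y′
    (trans (sym (vertQ-embed y)) (trans (cong QVertices.embed e) (vertQ-embed y′)))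

  vertQ-σQ-iter : ∀ y k → vertQ (iter k σQ y) ≡ vertQ y
  vertQ-σQ-iter y k = QVertices.embed-injective
    (trans (vertQ-embed _) (trans (vertₒ-σQ-iter k y) (sym (vertQ-embed y))))

  Q : Map
  Q = record
    { nD = count kept? ; nV = count qVertex? ; nF = n₁
    ; σ = injective⇒permutation σQ induced-injective
    ; α = permutation αQ αQ αQ-involutive αQ-involutive
    ; vert = vertQ
    ; face = faceQ
    }

  infix 4 _~_
  _~_ : DQ → DQ → Set
  y ~ y′ = Reach Q y y′

  ~-trans : ∀ {y y′ y″} → y ~ y′ → y′ ~ y″ → y ~ y″
  ~-trans here      r = r
  ~-trans (stepσ r) r′ = stepσ (~-trans r r′)
  ~-trans (stepα r) r′ = stepα (~-trans r r′)

  ~-σQ-iter : ∀ k y → y ~ iter k σQ y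
  ~-σQ-iter zero    y = here
  ~-σQ-iter (suc k) y = stepσ (subst (σQ y ~_) (sym (iter-sucʳ k σQ y)) (~-σQ-iter k (σQ y)))

  ~-same-vertex : ∀ y y′ → vertₒ (ι y) ≡ vertₒ (ι y′) → y ~ y′
  ~-same-vertex y y′ e = let k , eₖ = same-vertₒ⇒σQ-orbit y y′ e in subst (y ~_) eₖ (~-σQ-iter k y)

  ~-sym : ∀ {y y′} → y ~ y′ → y′ ~ y
  ~-sym here          = here
  ~-sym {y} (stepσ r) = ~-trans (~-sym r) (~-same-vertex (σQ y) y (vertₒ-σQ-iter 1 y))
  ~-sym {y} (stepα r) = ~-trans (~-sym r) (stepα (subst (_~ y) (sym (αQ-involutive y)) here))

  -- Vertices of O missing from Q (colour 1, not v₁) are represented by one of their neighbours.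
  anchorOf : ∀ v → Dec (QVertex v) → V
  anchorOf v (yes _) = v
  anchorOf v (no _)  = vertₒ (αₒ (proj₁ (vert-surj v)))

  anchorOf-qVertex : ∀ v d → QVertex (anchorOf v d)
  anchorOf-qVertex v (yes q) = q
  anchorOf-qVertex v (no ¬q) = inj₁ λ neighbour≡1 →
    proper z (trans (cong c (proj₂ (vert-surj v))) (trans v≡1 (sym neighbour≡1)))
    where
    z : D
    z = proj₁ (vert-surj v)
    v≡1 : c v ≡ col1
    v≡1 = decidable-stable (c v ≟ col1) (¬q ∘ inj₁)

  anchorOf-id : ∀ v d → QVertex v → anchorOf v d ≡ v
  anchorOf-id v (yes _) _ = refl
  anchorOf-id v (no ¬q) q = contradiction q ¬q

  opaque
    dart-near : V → DQ
    dart-near v = let x , kept , _ = qVertex⇒kept (anchorOf v (qVertex? v)) (anchorOf-qVertex v (qVertex? v))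
                  in Darts.index x kept

    dart-near-vert : ∀ v → vertₒ (ι (dart-near v)) ≡ anchorOf v (qVertex? v)
    dart-near-vert v = let x , kept , x-at = qVertex⇒kept (anchorOf v (qVertex? v)) (anchorOf-qVertex v (qVertex? v))
                       in trans (cong vertₒ (Darts.embed-index x kept)) x-at

  dart-near-qVertex : ∀ v → QVertex v → vertₒ (ι (dart-near v)) ≡ v
  dart-near-qVertex v q = trans (dart-near-vert v) (anchorOf-id v (qVertex? v) q)

  infix 4 _~ᵥ_
  _~ᵥ_ : V → V → Set
  u ~ᵥ w = dart-near u ~ dart-near w

  ~ᵥ-kept-edge : ∀ x → ColourOneEdge x → vertₒ x ~ᵥ vertₒ (αₒ x)
  ~ᵥ-kept-edge x edge@(x≢1 , αx≢1) =
    ~-trans (~-same-vertex _ y (trans (dart-near-qVertex _ (inj₁ x≢1)) (cong vertₒ (sym ι-y))))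
            (stepα (~-same-vertex _ _ (trans (cong vertₒ (trans (ι-αQ y) (cong αₒ ι-y)))
                                             (sym (dart-near-qVertex _ (inj₁ αx≢1))))))
    where
    y : DQ
    y = Darts.index x (inj₁ edge)
    ι-y : ι y ≡ x
    ι-y = Darts.embed-index _ _

  -- The neighbours of a colour-1 vertex lie on a cycle of edges of colour 1: consecutive darts x, σ x
  -- at it span a triangle whose side opposite it is φ (σ x).
  ~ᵥ-around : ∀ {v} → c v ≡ col1 → ∀ x → vertₒ x ≡ v → vertₒ (αₒ x) ~ᵥ vertₒ (αₒ (σₒ x))
  ~ᵥ-around v≡1 x x-at =
    ~-sym (subst₂ _~ᵥ_ (vert-φ (σₒ x)) opposite-end (~ᵥ-kept-edge side side-edge))
    where
    side : D
    side = φₒ (σₒ x)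
    opposite-end : vertₒ (αₒ side) ≡ vertₒ (αₒ x)
    opposite-end = trans (sym (vert-φ side)) (cong vertₒ (φ²∘σ≡α x))
    σx≡1 : colour (σₒ x) ≡ col1
    σx≡1 = trans (cong c (trans (vert-σ x) x-at)) v≡1
    side-edge : ColourOneEdge side
    side-edge = (λ e → proper (σₒ x) (trans σx≡1 (sym (trans (sym (cong c (vert-φ (σₒ x)))) e))))
              , (λ e → proper x (trans (trans (cong c x-at) v≡1) (sym (trans (cong c (sym opposite-end)) e))))

  ~ᵥ-around-iter : ∀ {v} → c v ≡ col1 → ∀ m x → vertₒ x ≡ v → vertₒ (αₒ x) ~ᵥ vertₒ (αₒ (iter m σₒ x))
  ~ᵥ-around-iter v≡1 zero    x x-at = here
  ~ᵥ-around-iter v≡1 (suc m) x x-at =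
    ~-trans (~ᵥ-around-iter v≡1 m x x-at) (~ᵥ-around v≡1 (iter m σₒ x) (trans (vert-orb₂ x m) x-at))

  ~ᵥ-some-neighbour : ∀ v → c v ≡ col1 → Dec (QVertex v) → ∃ λ z → vertₒ z ≡ v × v ~ᵥ vertₒ (αₒ z)
  ~ᵥ-some-neighbour v v≡1 (yes q) =
    z , dart-near-qVertex v q ,
    stepα (~-same-vertex _ _ (trans (cong vertₒ (ι-αQ (dart-near v))) (sym (dart-near-qVertex _ (inj₁ neighbour≢1)))))
    where
    z : D
    z = ι (dart-near v)
    neighbour≢1 : colour (αₒ z) ≢ col1
    neighbour≢1 e = proper z (trans (trans (cong c (dart-near-qVertex v q)) v≡1) (sym e))
  ~ᵥ-some-neighbour v v≡1 (no ¬q) =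
    z , proj₂ (vert-surj v) ,
    ~-same-vertex _ _ (trans (dart-near-vert v) (trans (anchor-no (qVertex? v)) (sym (dart-near-qVertex _ neighbour))))
    where
    z : D
    z = proj₁ (vert-surj v)
    neighbour : QVertex (vertₒ (αₒ z))
    neighbour = anchorOf-qVertex v (no ¬q)
    anchor-no : ∀ d → anchorOf v d ≡ vertₒ (αₒ z)
    anchor-no (yes q) = contradiction q ¬q
    anchor-no (no _)  = refl

  ~ᵥ-neighbour : ∀ v → c v ≡ col1 → ∀ x → vertₒ x ≡ v → v ~ᵥ vertₒ (αₒ x)
  ~ᵥ-neighbour v v≡1 x x-at =
    let z , z-at , start = ~ᵥ-some-neighbour v v≡1 (qVertex? v)
        m , eₘ = vert-orb₁ z x (trans z-at (sym x-at))
    in ~-trans start (subst (λ t → vertₒ (αₒ z) ~ᵥ vertₒ (αₒ t)) eₘ (~ᵥ-around-iter v≡1 m z z-at))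

  ~ᵥ-edge : ∀ x → vertₒ x ~ᵥ vertₒ (αₒ x)
  ~ᵥ-edge x = by-colours (colour x ≟ col1) (colour (αₒ x) ≟ col1)
    where
    by-colours : Dec (colour x ≡ col1) → Dec (colour (αₒ x) ≡ col1) → vertₒ x ~ᵥ vertₒ (αₒ x)
    by-colours (yes x≡1) _          = ~ᵥ-neighbour (vertₒ x) x≡1 x refl
    by-colours (no _)    (yes αx≡1) = ~-sym (subst (λ t → vertₒ (αₒ x) ~ᵥ vertₒ t) (α-invol x)
                                                   (~ᵥ-neighbour (vertₒ (αₒ x)) αx≡1 (αₒ x) refl))
    by-colours (no x≢1)  (no αx≢1)  = ~ᵥ-kept-edge x (x≢1 , αx≢1)

  ~ᵥ-reach : ∀ {x x′} → Reach O x x′ → vertₒ x ~ᵥ vertₒ x′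
  ~ᵥ-reach here                = here
  ~ᵥ-reach {x} {x′} (stepσ r) = subst (_~ᵥ vertₒ x′) (vert-σ x) (~ᵥ-reach r)
  ~ᵥ-reach {x} (stepα r)      = ~-trans (~ᵥ-edge x) (~ᵥ-reach r)

  Q-connected : ∀ y y′ → y ~ y′
  Q-connected y y′ =
    ~-trans (~-same-vertex y _ (sym (dart-near-qVertex _ (kept⇒qVertex _ (Darts.embed-∈ y)))))
            (~-trans (~ᵥ-reach (connected (ι y) (ι y′)))
                     (~-same-vertex _ y′ (dart-near-qVertex _ (kept⇒qVertex _ (Darts.embed-∈ y′)))))

  [v₁≡1] : ℕ
  [v₁≡1] = indicator (c v₁ ≟ col1)

  -- Double counting the darts at colour-1 vertices: one per face of O, four at each such vertex but v₁.
  degree-count : nF O + 2 * [v₁≡1] ≡ 4 * n₁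
  degree-count = +-cancelʳ-≡ (2 * [v₁≡1]) _ _ (begin
    nF O + 2 * [v₁≡1] + 2 * [v₁≡1]   ≡⟨ regroup₁ (nF O) [v₁≡1] ⟩
    nF O + [v₁≡1] * 4                ≡⟨ cong (_+ [v₁≡1] * 4) darts-at-colour-one ⟨
    sum atColourOne + [v₁≡1] * 4     ≡⟨ ∑-agree-except atColourOne four v₁ agree ⟩
    sum four + atColourOne v₁        ≡⟨ cong₂ _+_ (sym (*-distribʳ-sum 4 (indicator ∘ colourOne?))) at-v₁ ⟩
    n₁ * 4 + [v₁≡1] * 2              ≡⟨ regroup₂ n₁ [v₁≡1] ⟩
    4 * n₁ + 2 * [v₁≡1]              ∎)
    where
    open ≡-Reasoning
    atColourOne four : V → ℕ
    atColourOne v = indicator (colourOne? v) * count (λ x → vertₒ x ≟ v)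
    four v = indicator (colourOne? v) * 4
    darts-at-colour-one : sum atColourOne ≡ nF O
    darts-at-colour-one = trans (∑-fibres vertₒ colourOne?) (count-colour col1)
    agree : ∀ v → v ≢ v₁ → atColourOne v ≡ four v
    agree v v≢v₁ = indicator-*-cong (colourOne? v) λ v≡1 →
      trans (sym (countFibre≡count vertₒ v)) (other-deg v (colour-one⇒≢v₀ v≡1) v≢v₁ (colour-one⇒≢v₂ v≡1) v≡1)
    at-v₁ : atColourOne v₁ ≡ [v₁≡1] * 2
    at-v₁ = indicator-*-cong (c v₁ ≟ col1) λ v₁≡1 → trans (sym (countFibre≡count vertₒ v₁)) (v₁-deg v₁≡1)
    regroup₁ : ∀ f b → f + 2 * b + 2 * b ≡ f + b * 4
    regroup₁ = solve-∀
    regroup₂ : ∀ n b → n * 4 + b * 2 ≡ 4 * n + 2 * b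
    regroup₂ = solve-∀

  vertex-indicators : ∀ v (q : Dec (QVertex v)) (o : Dec (c v ≡ col1)) (s : Dec (v ≡ v₁ × c v₁ ≡ col1))
                    → indicator q + indicator o ≡ 1 + indicator s
  vertex-indicators v (yes _)         (yes _)   (yes _)           = refl
  vertex-indicators v (yes (inj₁ ≢1)) (yes v≡1) (no _)            = contradiction v≡1 ≢1
  vertex-indicators v (yes (inj₂ s))  (yes _)   (no ¬s)           = contradiction s ¬s
  vertex-indicators v (no ¬q)         (yes _)   (yes s)           = contradiction (inj₂ s) ¬q
  vertex-indicators v (no _)          (yes _)   (no _)            = refl
  vertex-indicators v (yes _)         (no _)    (no _)            = refl
  vertex-indicators v (yes _)         (no ≢1)   (yes (refl , v≡1)) = contradiction v≡1 ≢1
  vertex-indicators v (no ¬q)         (no ≢1)   _                 = contradiction (inj₁ ≢1) ¬q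

  count-v₁ : (d : Dec (c v₁ ≡ col1)) → count (λ v → (v ≟ v₁) ×-dec d) ≡ indicator d
  count-v₁ (yes v₁≡1) = count-≡ (λ v → (v ≟ v₁) ×-dec yes v₁≡1) (v₁ ∷ []) (∷-injective []-injective λ ())
                                (λ { zero → refl , v₁≡1 }) (λ v (v≡v₁ , _) → zero , sym v≡v₁)
  count-v₁ (no v₁≢1)  = count-none (λ v → (v ≟ v₁) ×-dec no v₁≢1) (λ v (_ , v₁≡1) → v₁≢1 v₁≡1)

  vertex-count : count qVertex? + n₁ ≡ nV O + [v₁≡1]
  vertex-count = trans (count-+ qVertex? colourOne? U? (λ v → (v ≟ v₁) ×-dec (c v₁ ≟ col1))
                                (λ v → vertex-indicators v (qVertex? v) (colourOne? v) ((v ≟ v₁) ×-dec (c v₁ ≟ col1))))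
                       (cong₂ _+_ (count-all U? (λ _ → tt)) (count-v₁ (c v₁ ≟ col1)))

  vertices-Q : count qVertex? ≡ n₁ + 2
  vertices-Q = +-cancelʳ-≡ n₁ _ _ (*-cancelˡ-≡ _ _ 2 (begin
    2 * (count qVertex? + n₁)    ≡⟨ cong (2 *_) vertex-count ⟩
    2 * (nV O + [v₁≡1])          ≡⟨ *-distribˡ-+ 2 (nV O) [v₁≡1] ⟩
    2 * nV O + 2 * [v₁≡1]        ≡⟨ cong (_+ 2 * [v₁≡1]) (plane⇒2*vertices (proj₁ (proj₂ triang))) ⟩
    4 + nF O + 2 * [v₁≡1]        ≡⟨ +-assoc 4 (nF O) (2 * [v₁≡1]) ⟩
    4 + (nF O + 2 * [v₁≡1])      ≡⟨ cong (4 +_) degree-count ⟩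
    4 + 4 * n₁                   ≡⟨ regroup n₁ ⟩
    2 * (n₁ + 2 + n₁)            ∎))
    where
    open ≡-Reasoning
    regroup : ∀ n → 4 + 4 * n ≡ 2 * (n + 2 + n)
    regroup = solve-∀

  darts-Q : count kept? ≡ 4 * n₁
  darts-Q = fibres-of-size faceQ 4 faceQ-size

  Q-isPlane : IsPlane Q
  Q-isPlane = begin
    2 * (count qVertex? + n₁)   ≡⟨ cong (λ t → 2 * (t + n₁)) vertices-Q ⟩
    2 * (n₁ + 2 + n₁)           ≡⟨ regroup n₁ ⟩
    4 + 4 * n₁                  ≡⟨ cong (4 +_) darts-Q ⟨
    4 + count kept?             ∎
    where
    open ≡-Reasoning
    regroup : ∀ n → 2 * (n + 2 + n) ≡ 4 + 4 * n
    regroup = solve-∀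

  Q-isMap : IsMap Q
  Q-isMap = record
    { α-invol   = αQ-involutive
    ; α-nofix   = λ y e → α-nofix (ι y) (trans (sym (ι-αQ y)) (cong ι e))
    ; vert-surj = vertQ-surjective
    ; vert-orb₁ = vertQ-orbit
    ; vert-orb₂ = vertQ-σQ-iter
    ; face-surj = faceQ-surjective
    ; face-orb₁ = λ y y′ e → φQ-orbit y y′ (trans (faceQ⇒centre y (faceQ y′) e) (faceQ-embed y′))
    ; face-orb₂ = λ y k → faceQ-≡ _ (faceQ y) (trans (centre-φQ-iter k y) (sym (faceQ-embed y)))
    ; connected = Q-connected
    }

  Q-isQuadrangulation : IsPlaneQuadrangulation Q
  Q-isQuadrangulation = Q-isMap , Q-isPlane , faceQ-size

  Q-isPredecoration : IsPredecorationVia O c v₁ Q ι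
  Q-isPredecoration = record
    { ι-inj  = Darts.embed-injective
    ; ι-in   = Darts.embed-∈
    ; ι-onto = λ x kept → Darts.index x kept , Darts.embed-index x kept
    ; ι-α    = ι-αQ
    ; ι-σ    = λ y → let r = induced-return y in
                 Return.steps r , Return.steps>0 r , sym (induced-image y) , Return.avoids r
    }

  half-degree-count : ∀ k → nF O ≡ 2 * k → k + [v₁≡1] ≡ 2 * n₁
  half-degree-count k faces = *-cancelˡ-≡ _ _ 2 (begin
    2 * (k + [v₁≡1])      ≡⟨ *-distribˡ-+ 2 k [v₁≡1] ⟩
    2 * k + 2 * [v₁≡1]    ≡⟨ cong (_+ 2 * [v₁≡1]) faces ⟨
    nF O + 2 * [v₁≡1]     ≡⟨ degree-count ⟩
    4 * n₁                ≡⟨ *-assoc 2 2 n₁ ⟩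
    2 * (2 * n₁)          ∎)
    where open ≡-Reasoning

  predecoration : ∀ k → nF O ≡ 2 * k → QuadrangularPredecoration O c v₁ (k + [v₁≡1] + 4)
  predecoration k faces = Q , ι , Q-isPredecoration , Q-isQuadrangulation , (begin
    2 * count qVertex?    ≡⟨ cong (2 *_) vertices-Q ⟩
    2 * (n₁ + 2)          ≡⟨ *-distribˡ-+ 2 n₁ 2 ⟩
    2 * n₁ + 4            ≡⟨ cong (_+ 4) (half-degree-count k faces) ⟨
    k + [v₁≡1] + 4        ∎)
    where open ≡-Reasoning

indicator-parity : ∀ {A : Set} (d : Dec A) {k n} → k + indicator d ≡ 2 * n → (2 ∣ k → ¬ A) × (¬ 2 ∣ k → A)
indicator-parity (yes a) {k} {n} k+1≡2n = (λ 2∣k _ → 2∤1 (∣m+n∣m⇒∣n 2∣k+1 2∣k)) , λ _ → a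
  where
  2∣k+1 : 2 ∣ k + 1
  2∣k+1 = subst (2 ∣_) (sym k+1≡2n) (m∣m*n n)
  2∤1 : ¬ (2 ∣ 1)
  2∤1 2∣1 with ∣1⇒≡1 2∣1
  ... | ()
indicator-parity (no ¬a) {k} {n} k≡2n =
  (λ _ → ¬a) , λ 2∤k → contradiction (subst (2 ∣_) (trans (sym k≡2n) (+-identityʳ k)) (m∣m*n n)) 2∤k

lemma7 : (O : Map) (c : Fin (nV O) → Fin 3) (v₀ v₁ v₂ : Fin (nV O))
         → IsLopsp O c v₀ v₁ v₂
         → (k : ℕ) → nF O ≡ 2 * k
         → ((2 ∣ k) → c v₁ ≢ col1
              × Σ Map (λ Q → Σ (Fin (nD Q) → Fin (nD O)) (λ ι →
                  IsPredecorationVia O c v₁ Q ι × IsPlaneQuadrangulation Q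
                  × 2 * nV Q ≡ k + 4)))
           × ((¬ (2 ∣ k)) → c v₁ ≡ col1
              × Σ Map (λ Q → Σ (Fin (nD Q) → Fin (nD O)) (λ ι →
                  IsPredecorationVia O c v₁ Q ι × IsPlaneQuadrangulation Q
                  × 2 * nV Q ≡ k + 5)))
lemma7 O c v₀ v₁ v₂ lopsp k faces≡2k = even , odd
  where
  open Predecoration O c v₀ v₁ v₂ lopsp
  parity : (2 ∣ k → c v₁ ≢ col1) × (¬ 2 ∣ k → c v₁ ≡ col1)
  parity = indicator-parity (c v₁ ≟ col1) {k} {n₁} (half-degree-count k faces≡2k)
  even : 2 ∣ k → c v₁ ≢ col1 × QuadrangularPredecoration O c v₁ (k + 4)
  even 2∣k = v₁≢1 , subst (QuadrangularPredecoration O c v₁) vertices (predecoration k faces≡2k)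
    where
    v₁≢1 : c v₁ ≢ col1
    v₁≢1 = proj₁ parity 2∣k
    vertices : k + [v₁≡1] + 4 ≡ k + 4
    vertices = trans (cong (λ b → k + b + 4) (indicator-no (c v₁ ≟ col1) v₁≢1)) (cong (_+ 4) (+-identityʳ k))
  odd : ¬ 2 ∣ k → c v₁ ≡ col1 × QuadrangularPredecoration O c v₁ (k + 5)
  odd 2∤k = v₁≡1 , subst (QuadrangularPredecoration O c v₁) vertices (predecoration k faces≡2k)
    where
    v₁≡1 : c v₁ ≡ col1
    v₁≡1 = proj₂ parity 2∤k
    vertices : k + [v₁≡1] + 4 ≡ k + 5
    vertices = trans (cong (λ b → k + b + 4) (indicator-yes (c v₁ ≟ col1) v₁≡1)) (+-assoc k 1 4)
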